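{- Let $r=m+n$. For $\mathbf u,\mathbf v\in\mathsf{Shuf}(m,n)$, we have $\dim(F_{\mathbf u}\cap F_{\mathbf v})=r-2$ if and only if either $\mathbf u\lessdot\mathbf v$ or $\mathbf v\lessdot\mathbf u$ in the bubble lattice $\mathbf{Bub}(m,n)$.
   Context: Fix $m,n\geq0$, $X=\{x_1,\dots,x_m\}$, $Y=\{y_1,\dots,y_n\}$. A shuffle word is a word over $X\cup Y$ without repeated letters in which $x_i$ precedes $x_j$ and $y_i$ precedes $y_j$ whenever both occur and $i<j$; $\mathsf{Shuf}(m,n)$ is their set. The bubble lattice $\mathbf{Bub}(m,n)$ orders $\mathsf{Shuf}(m,n)$ by the reflexive–transitive closure of: delete a letter of $X$; insert a letter of $Y$; replace a consecutive factor $xy$ ($x\in X,y\in Y$) by $yx$; $\lessdot$ denotes its cover relation. Let $\tilde X=X\cup\{x_0\}$, $\tilde Y=Y\cup\{y_0\}$, loops $\mathcal L=X\uplus Y$, edges $\tilde{\mathcal E}=\{\{x,y\}:x\in\tilde X,y\in\tilde Y\}\setminus\{\{x_0,y_0\}\}$. For $\mathbf w=w_1\cdots w_k\in\mathsf{Shuf}(m,n)$ put $\tilde{\mathbf w}=w_{ -1}w_0w_1\cdots w_k$ with $w_{ -1}=x_0$, $w_0=y_0$, and let $F_{\mathbf w}\subseteq\mathcal L\uplus\tilde{\mathcal E}$ consist of: all $z\in X\uplus Y$ not occurring in $\mathbf w$; for each $j\geq1$ with $w_j\in X$, the edge $\{w_j,w_i\}$ where $i=\max\{i'<j: w_{i'}\in\tilde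 Y\}$; for each $j\geq1$ with $w_j\in Y$, the edge $\{w_i,w_j\}$ where $i=\max\{i'<j:w_{i'}\in\tilde X\}$. (These sets are the facets of the noncrossing bipartite complex, of dimension $r-1$.) -}

module Defs where

open import Data.Nat using (ℕ; zero; suc; _+_)
open import Data.Fin using (Fin; toℕ) renaming (_<_ to _<ᶠ_; _≟_ to _≟ᶠ_)
open import Data.Fin as F using ()
open import Data.List using (List; []; _∷_; _++_; length; lookup; filter; map; allFin; concatMap)
open import Data.List.Relation.Unary.Unique.Propositional using (Unique)
open import Data.Product using (Σ; ∃; _×_; _,_; proj₁; proj₂)
open import Data.Sum using (_⊎_; inj₁; inj₂)
open import Data.Empty using (⊥)
open import Data.Integer using (ℤ; +_; _-_)
open import Relation.Nullary using (¬_; Dec; yes; no)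
open import Relation.Nullary.Decidable using (map′)
open import Relation.Binary.PropositionalEquality using (_≡_; _≢_; refl; cong; cong₂)
open import Relation.Binary.Definitions using (DecidableEquality)
open import Relation.Binary.Construct.Closure.ReflexiveTransitive using (Star)
import Data.List.Membership.DecPropositional as DecMem

-- Letters: x i (i : Fin m) stands for x_{i+1}, y j (j : Fin n) for y_{j+1}.

data Letter (m n : ℕ) : Set where
  x : Fin m → Letter m n
  y : Fin n → Letter m n

x-inj : ∀ {m n} {i j : Fin m} → x {n = n} i ≡ x j → i ≡ j
x-inj refl = refl

y-inj : ∀ {m n} {i j : Fin n} → y {m = m} i ≡ y j → i ≡ j
y-inj refl = refl

_≟L_ : ∀ {m n} → DecidableEquality (Letter m n)
x i ≟L x j = map′ (cong x) x-inj (i ≟ᶠ j)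
x i ≟L y j = no λ ()
y i ≟L x j = no λ ()
y i ≟L y j = map′ (cong y) y-inj (i ≟ᶠ j)

Word : ℕ → ℕ → Set
Word m n = List (Letter m n)

MustPrecede : ∀ {m n} → Letter m n → Letter m n → Set
MustPrecede (x i) (x j) = i <ᶠ j
MustPrecede (y i) (y j) = i <ᶠ j
MustPrecede _     _     = ⊥

IsShuf : ∀ {m n} → Word m n → Set
IsShuf w = Unique w ×
  (∀ (p q : Fin (length w)) → MustPrecede (lookup w p) (lookup w q) → p <ᶠ q)

Shuf : ℕ → ℕ → Set
Shuf m n = Σ (Word m n) IsShuf

data Move {m n : ℕ} : Word m n → Word m n → Set where
  delete-x : ∀ a b i → Move (a ++ x i ∷ b) (a ++ b)
  insert-y : ∀ a b j → Move (a ++ b) (a ++ y j ∷ b)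
  swap-xy  : ∀ a b i j → Move (a ++ x i ∷ y j ∷ b) (a ++ y j ∷ x i ∷ b)

BubStep : ∀ {m n} → Shuf m n → Shuf m n → Set
BubStep u v = Move (proj₁ u) (proj₁ v)

_≤Bub_ : ∀ {m n} → Shuf m n → Shuf m n → Set
_≤Bub_ = Star BubStep

_<Bub_ : ∀ {m n} → Shuf m n → Shuf m n → Set
u <Bub v = (u ≤Bub v) × (proj₁ u ≢ proj₁ v)

_⋖_ : ∀ {m n} → Shuf m n → Shuf m n → Set
u ⋖ v = (u <Bub v) × (¬ (Σ _ λ w → (u <Bub w) × (w <Bub v)))

-- Ground set  L ⊎ Ẽ  of the noncrossing bipartite complex.
-- edge a b (a : Fin (suc m), b : Fin (suc n)) is {x_a, y_b}, index 0 being x_0 / y_0;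
-- edge zero zero = {x_0,y_0} is excluded from Ẽ and never occurs in a facet.

data Elem (m n : ℕ) : Set where
  loopX : Fin m → Elem m n
  loopY : Fin n → Elem m n
  edge  : Fin (suc m) → Fin (suc n) → Elem m n

_≟E_ : ∀ {m n} → DecidableEquality (Elem m n)
loopX i ≟E loopX j with i ≟ᶠ j
... | yes refl = yes refl
... | no ne = no λ { refl → ne refl }
loopY i ≟E loopY j with i ≟ᶠ j
... | yes refl = yes refl
... | no ne = no λ { refl → ne refl }
edge a b ≟E edge c d with a ≟ᶠ c | b ≟ᶠ d
... | yes refl | yes refl = yes refl
... | no ne | _ = no λ { refl → ne refl }
... | _ | no ne = no λ { refl → ne refl }
loopX _ ≟E loopY _ = no λ ()
loopX _ ≟E edge _ _ = no λ ()
loopY _ ≟E loopX _ = no λ ()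
loopY _ ≟E edge _ _ = no λ ()
edge _ _ ≟E loopX _ = no λ ()
edge _ _ ≟E loopY _ = no λ ()

-- edges of F_w: scan w̃ = x_0 y_0 w_1 ... w_k remembering the last letter
-- of X̃ and of Ỹ seen so far.
edgesFrom : ∀ {m n} → Fin (suc m) → Fin (suc n) → Word m n → List (Elem m n)
edgesFrom lx ly []          = []
edgesFrom lx ly (x i ∷ w) = edge (F.suc i) ly ∷ edgesFrom (F.suc i) ly w
edgesFrom lx ly (y j ∷ w) = edge lx (F.suc j) ∷ edgesFrom lx (F.suc j) w

missing : ∀ {m n} → Word m n → Letter m n → List (Elem m n)
missing w l with DecMem._∈?_ _≟L_ l w
missing w l     | yes _ = []
missing w (x i) | no _  = loopX i ∷ []
missing w (y j) | no _  = loopY j ∷ []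

allLetters : (m n : ℕ) → List (Letter m n)
allLetters m n = map x (allFin m) ++ map y (allFin n)

F : ∀ {m n} → Word m n → List (Elem m n)
F {m} {n} w = concatMap (missing w) (allLetters m n) ++ edgesFrom F.zero F.zero w

_∩_ : ∀ {m n} → List (Elem m n) → List (Elem m n) → List (Elem m n)
A ∩ B = filter (λ e → DecMem._∈?_ _≟E_ e B) A

dim : ∀ {m n} → List (Elem m n) → ℤ
dim A = + length A - + 1

-- F w has one element per letter: the loop of an absent letter, or for a present letter the edge to the
-- last letter of the other kind before it (x₀ or y₀ if there is none). Deleting an x not followed by a y,
-- inserting a y not followed by an x, or swapping a factor x y changes exactly one of these elements, and
-- these cover moves are exactly the covers of the bubble lattice: every other move factors through a swap,
-- and the sets of letters and of y-before-x pairs change monotonically along the order, which rules out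
-- anything strictly between. Conversely, if F u and F v differ in a single element, look at the first
-- position where u and v differ. The letters there already account for one element of F u not in F v and
-- one of F v not in F u; inspecting the next letters shows that u and v must differ by a cover move, since
-- otherwise a later position (or a further absent letter) produces a second difference.

module Submission where

open import Defs
open import Data.Nat using (ℕ; _+_; suc; _≤_; s≤s; z≤n; s<s⁻¹)
import Data.Nat.Properties as ℕ
open import Data.Integer using (+_; _-_; -_)
import Data.Integer.Properties as ℤ
open import Algebra.Bundles using (AbelianGroup)
open import Algebra.Properties.Group (AbelianGroup.group ℤ.+-0-abelianGroup) using (∙-cancelʳ)
open import Data.Product using (proj₁; proj₂; Σ; ∃; _×_; _,_)
open import Data.Sum using (_⊎_; inj₁; inj₂; [_,_]′)
import Data.Sum as Sum
open import Data.Empty using (⊥; ⊥-elim)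
open import Data.Unit using (⊤; tt)
open import Function.Base using (id; _∘_)
open import Function.Bundles using (_⇔_; mk⇔; Equivalence)
open import Relation.Binary.PropositionalEquality
  using (_≡_; _≢_; refl; sym; trans; cong; cong₂; subst; subst₂; module ≡-Reasoning)
open import Relation.Nullary using (¬_; Dec; yes; no)
open import Relation.Binary.Definitions using (DecidableEquality; tri<; tri≈; tri>)
open import Relation.Binary.Construct.Closure.ReflexiveTransitive using (ε; _◅_)
open import Data.List using (List; []; _∷_; _++_; length; lookup; filter; map; allFin; concatMap)
import Data.List.Properties as List
open import Data.Fin using (Fin) renaming (zero to fzero; suc to fsuc; _<_ to _<ᶠ_)
import Data.Fin.Properties as Fin
open import Data.List.Membership.Propositional using (_∈_; _∉_)
open import Data.List.Membership.Propositional.Properties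
  using (∈-++⁺ˡ; ∈-++⁺ʳ; ∈-++⁻; ∈-insert; ∈-map⁺; ∈-map⁻; ∈-allFin; ∈-lookup)
import Data.List.Membership.DecPropositional as DecMembership
open import Data.List.Relation.Unary.Any using (here; there)
import Data.List.Relation.Unary.Any as Any
open import Data.List.Relation.Unary.All using (All; []; _∷_)
import Data.List.Relation.Unary.All as All
open import Data.List.Relation.Unary.Any.Properties using (lookup-index)
open import Data.List.Relation.Unary.All.Properties using (¬Any⇒All¬; All¬⇒¬Any)
open import Data.List.Relation.Unary.AllPairs using (AllPairs; []; _∷_)
open import Data.List.Relation.Unary.Unique.Propositional using (Unique)
open import Data.List.Relation.Unary.Unique.Propositional.Properties
  using (Unique[x∷xs]⇒x∉xs) renaming (++⁺ to unique-++⁺; map⁺ to unique-map⁺; allFin⁺ to unique-allFin)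

module _ {A : Set} where

  ∈-insert⁻ : ∀ (a : List A) {c b z} → z ∈ a ++ c ∷ b → z ≡ c ⊎ z ∈ a ++ b
  ∈-insert⁻ []      (here refl) = inj₁ refl
  ∈-insert⁻ []      (there p)   = inj₂ p
  ∈-insert⁻ (_ ∷ a) (here refl) = inj₂ (here refl)
  ∈-insert⁻ (_ ∷ a) (there p)   = Sum.map₂ there (∈-insert⁻ a p)

  ∈-insert⁺ : ∀ (a : List A) {c b z} → z ∈ a ++ b → z ∈ a ++ c ∷ b
  ∈-insert⁺ []      p           = there p
  ∈-insert⁺ (_ ∷ a) (here refl) = here refl
  ∈-insert⁺ (_ ∷ a) (there p)   = there (∈-insert⁺ a p)

  ∈-swap : ∀ (a : List A) {c d b z} → z ∈ a ++ c ∷ d ∷ b → z ∈ a ++ d ∷ c ∷ b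
  ∈-swap []      (here refl)         = there (here refl)
  ∈-swap []      (there (here refl)) = here refl
  ∈-swap []      (there (there p))   = there (there p)
  ∈-swap (_ ∷ a) (here refl)         = here refl
  ∈-swap (_ ∷ a) (there p)           = there (∈-swap a p)

  ∉-++ : ∀ (a : List A) {b z} → z ∉ a → z ∉ b → z ∉ a ++ b
  ∉-++ a z∉a z∉b p = [ z∉a , z∉b ]′ (∈-++⁻ a p)

  ∉-insert : ∀ (a : List A) {c b z} → z ∉ a → z ≢ c → z ∉ b → z ∉ a ++ c ∷ b
  ∉-insert a z∉a z≢c z∉b p = [ z≢c , ∉-++ a z∉a z∉b ]′ (∈-insert⁻ a p)

  ∈-∷-≢ : ∀ {z c} {b : List A} → z ∈ c ∷ b → z ≢ c → z ∈ b
  ∈-∷-≢ (here z≡c) z≢c = ⊥-elim (z≢c z≡c)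
  ∈-∷-≢ (there p)  _   = p

  allPairs-swap : ∀ {R : A → A → Set} (a : List A) {c d b} →
                  AllPairs R (a ++ c ∷ d ∷ b) → R d c → AllPairs R (a ++ d ∷ c ∷ b)
  allPairs-swap []      ((_ ∷ rcb) ∷ rdb ∷ rb) rdc = (rdc ∷ rdb) ∷ rcb ∷ rb
  allPairs-swap (_ ∷ a) (ra ∷ rs)              rdc = all-swap a ra ∷ allPairs-swap a rs rdc
    where
    all-swap : ∀ {P : A → Set} (a : List A) {c d b} → All P (a ++ c ∷ d ∷ b) → All P (a ++ d ∷ c ∷ b)
    all-swap []      (pc ∷ pd ∷ ps) = pd ∷ pc ∷ ps
    all-swap (_ ∷ a) (p ∷ ps)       = p ∷ all-swap a ps

  length-insert : ∀ (a : List A) {c b} → length (a ++ c ∷ b) ≡ suc (length (a ++ b))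
  length-insert []      = refl
  length-insert (_ ∷ a) = cong suc (length-insert a)

  unique-tail : ∀ {c} {b : List A} → Unique (c ∷ b) → Unique b
  unique-tail (_ ∷ u) = u

  unique-++⁻ʳ : ∀ (a : List A) {b} → Unique (a ++ b) → Unique b
  unique-++⁻ʳ []      u       = u
  unique-++⁻ʳ (_ ∷ a) (_ ∷ u) = unique-++⁻ʳ a u

  unique-++-disjoint : ∀ (a : List A) {b z} → Unique (a ++ b) → z ∈ a → z ∉ b
  unique-++-disjoint (_ ∷ a) {b} (c≢ ∷ _) (here refl) = All¬⇒¬Any (drop-prefix a c≢)
    where
    drop-prefix : ∀ (a : List A) {P : A → Set} → All P (a ++ b) → All P b
    drop-prefix []      ps       = ps
    drop-prefix (_ ∷ a) (_ ∷ ps) = drop-prefix a ps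
  unique-++-disjoint (_ ∷ a) (_ ∷ u) (there p) = unique-++-disjoint a u p

  unique-insert⁻ : ∀ (a : List A) {c b} → Unique (a ++ c ∷ b) → c ∉ a × c ∉ b
  unique-insert⁻ a u =
    (λ p → unique-++-disjoint a u p (here refl)) , Unique[x∷xs]⇒x∉xs (unique-++⁻ʳ a u)

  unique-delete : ∀ (a : List A) {c b} → Unique (a ++ c ∷ b) → Unique (a ++ b)
  unique-delete []      (_ ∷ u)   = u
  unique-delete (_ ∷ a) (ne ∷ u) = All-delete a ne ∷ unique-delete a u
    where
    All-delete : ∀ (a : List A) {c b} {P : A → Set} → All P (a ++ c ∷ b) → All P (a ++ b)
    All-delete []      (_ ∷ ps) = ps
    All-delete (_ ∷ a) (p ∷ ps) = p ∷ All-delete a ps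

module _ {A : Set} where

  data Before (a b : A) : List A → Set where
    before-here  : ∀ {w} → b ∈ w → Before a b (a ∷ w)
    before-there : ∀ {c w} → Before a b w → Before a b (c ∷ w)

  before-∈ˡ : ∀ {a b w} → Before a b w → a ∈ w
  before-∈ˡ (before-here _)  = here refl
  before-∈ˡ (before-there p) = there (before-∈ˡ p)

  before-∈ʳ : ∀ {a b w} → Before a b w → b ∈ w
  before-∈ʳ (before-here p)  = there p
  before-∈ʳ (before-there p) = there (before-∈ʳ p)

  before-total : ∀ {a b} (w : List A) → a ∈ w → b ∈ w → a ≢ b → Before a b w ⊎ Before b a w
  before-total (_ ∷ w) (here refl) (here refl) a≢b = ⊥-elim (a≢b refl)
  before-total (_ ∷ w) (here refl) (there q)   _   = inj₁ (before-here q)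
  before-total (_ ∷ w) (there p)   (here refl) _   = inj₂ (before-here p)
  before-total (_ ∷ w) (there p)   (there q)   a≢b =
    Sum.map before-there before-there (before-total w p q a≢b)

  before-asym : ∀ {a b w} → Unique w → Before a b w → ¬ Before b a w
  before-asym u (before-here p)  (before-here q)  = Unique[x∷xs]⇒x∉xs u q
  before-asym u (before-here p)  (before-there q) = Unique[x∷xs]⇒x∉xs u (before-∈ʳ q)
  before-asym u (before-there p) (before-here q)  = Unique[x∷xs]⇒x∉xs u (before-∈ʳ p)
  before-asym u (before-there p) (before-there q) = before-asym (unique-tail u) p q

  before-irrefl : ∀ {a w} → Unique w → ¬ Before a a w
  before-irrefl u p = before-asym u p p

  before-trans : ∀ {a b c w} → Unique w → Before a b w → Before b c w → Before a c w
  before-trans u (before-here p)  (before-here q)  = ⊥-elim (Unique[x∷xs]⇒x∉xs u p)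
  before-trans u (before-here p)  (before-there q) = before-here (before-∈ʳ q)
  before-trans u (before-there p) (before-here q)  = ⊥-elim (Unique[x∷xs]⇒x∉xs u (before-∈ʳ p))
  before-trans u (before-there p) (before-there q) = before-there (before-trans (unique-tail u) p q)

  before-++ˡ : ∀ (a : List A) {c z w} → Before c z w → Before c z (a ++ w)
  before-++ˡ []      p = p
  before-++ˡ (_ ∷ a) p = before-there (before-++ˡ a p)

  before-inserted : ∀ (a : List A) {z c b} → z ∈ a → Before z c (a ++ c ∷ b)
  before-inserted (_ ∷ a) (here refl) = before-here (∈-insert a)
  before-inserted (_ ∷ a) (there p)   = before-there (before-inserted a p)

  after-inserted : ∀ (a : List A) {c b z} → Unique (a ++ c ∷ b) → Before c z (a ++ c ∷ b) → z ∈ b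
  after-inserted []      u (before-here p)  = p
  after-inserted []      u (before-there p) = ⊥-elim (Unique[x∷xs]⇒x∉xs u (before-∈ˡ p))
  after-inserted (_ ∷ a) u (before-here p)  = ⊥-elim (Unique[x∷xs]⇒x∉xs u (∈-insert a))
  after-inserted (_ ∷ a) u (before-there p) = after-inserted a (unique-tail u) p

  before-insert : ∀ (a : List A) {p q c b} → Before p q (a ++ b) → Before p q (a ++ c ∷ b)
  before-insert []      r                = before-there r
  before-insert (_ ∷ a) (before-here r)  = before-here (∈-insert⁺ a r)
  before-insert (_ ∷ a) (before-there r) = before-there (before-insert a r)

  before-delete : ∀ (a : List A) {p q c b} → Before p q (a ++ c ∷ b) → p ≢ c → q ≢ c →
                  Before p q (a ++ b)
  before-delete []      (before-here _)  p≢c _   = ⊥-elim (p≢c refl)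
  before-delete []      (before-there r) _   _   = r
  before-delete (_ ∷ a) (before-here r)  _   q≢c = before-here ([ ⊥-elim ∘ q≢c , id ]′ (∈-insert⁻ a r))
  before-delete (_ ∷ a) (before-there r) p≢c q≢c = before-there (before-delete a r p≢c q≢c)

  before-swap : ∀ (a : List A) {p q c d b} → Before p q (a ++ c ∷ d ∷ b) → ¬ (p ≡ c × q ≡ d) →
                Before p q (a ++ d ∷ c ∷ b)
  before-swap []      (before-here (here refl))       ne = ⊥-elim (ne (refl , refl))
  before-swap []      (before-here (there r))         _  = before-there (before-here r)
  before-swap []      (before-there (before-here r))  _  = before-here (there r)
  before-swap []      (before-there (before-there r)) _  = before-there (before-there r)
  before-swap (_ ∷ a) (before-here r)                 _  = before-here (∈-swap a r)
  before-swap (_ ∷ a) (before-there r)                ne = before-there (before-swap a r ne)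

  unique-≡ : ∀ (u w : List A) → Unique u → Unique w → (∀ {z} → z ∈ u → z ∈ w) →
             (∀ {z} → z ∈ w → z ∈ u) → (∀ {p q} → Before p q u → Before p q w) → u ≡ w
  unique-≡ []      []      _  _  _    _    _    = refl
  unique-≡ []      (_ ∷ _) _  _  _    w⊆u  _    with w⊆u (here refl)
  ... | ()
  unique-≡ (_ ∷ _) []      _  _  u⊆w  _    _    with u⊆w (here refl)
  ... | ()
  unique-≡ (a ∷ u) (c ∷ w) uu uw u⊆w w⊆u bef with w⊆u (here refl)
  ... | there c∈u with bef (before-here c∈u)
  ...   | before-here _  = ⊥-elim (Unique[x∷xs]⇒x∉xs uu c∈u)
  ...   | before-there r = ⊥-elim (Unique[x∷xs]⇒x∉xs uw (before-∈ʳ r))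
  unique-≡ (a ∷ u) (.a ∷ w) uu uw u⊆w w⊆u bef | here refl =
    cong (a ∷_) (unique-≡ u w (unique-tail uu) (unique-tail uw) tail⊆ tail⊇ tail-bef)
    where
    tail⊆ : ∀ {z} → z ∈ u → z ∈ w
    tail⊆ p = ∈-∷-≢ (u⊆w (there p)) λ { refl → Unique[x∷xs]⇒x∉xs uu p }
    tail⊇ : ∀ {z} → z ∈ w → z ∈ u
    tail⊇ p = ∈-∷-≢ (w⊆u (there p)) λ { refl → Unique[x∷xs]⇒x∉xs uw p }
    tail-bef : ∀ {p q} → Before p q u → Before p q w
    tail-bef r with bef (before-there r)
    ... | before-here _   = ⊥-elim (Unique[x∷xs]⇒x∉xs uu (before-∈ˡ r))
    ... | before-there r' = r'

module Shared {A : Set} (_≟_ : DecidableEquality A) where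
  open DecMembership _≟_ using (_∈?_)

  shared : List A → List A → ℕ
  shared X B = length (filter (_∈? B) X)

  shared-∷ˡ-∈ : ∀ {e X B} → e ∈ B → shared (e ∷ X) B ≡ suc (shared X B)
  shared-∷ˡ-∈ {B = B} e∈B = cong length (List.filter-accept (_∈? B) e∈B)

  shared-∷ˡ-∉ : ∀ {e X B} → e ∉ B → shared (e ∷ X) B ≡ shared X B
  shared-∷ˡ-∉ {B = B} e∉B = cong length (List.filter-reject (_∈? B) e∉B)

  shared-⊆ : ∀ X B → (∀ {e} → e ∈ X → e ∈ B) → shared X B ≡ length X
  shared-⊆ X B X⊆B = cong length (List.filter-all (_∈? B) (All.tabulate X⊆B))

  shared-cong : ∀ X S S' → (∀ {e} → e ∈ X → e ∈ S → e ∈ S') →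
                (∀ {e} → e ∈ X → e ∈ S' → e ∈ S) → shared X S ≡ shared X S'
  shared-cong []      S S' _ _ = refl
  shared-cong (e ∷ X) S S' to from with e ∈? S | e ∈? S'
  ... | yes _  | yes _   = cong suc (shared-cong X S S' (to ∘ there) (from ∘ there))
  ... | no _   | no _    = shared-cong X S S' (to ∘ there) (from ∘ there)
  ... | yes p  | no ¬p'  = ⊥-elim (¬p' (to (here refl) p))
  ... | no ¬p  | yes p'  = ⊥-elim (¬p (from (here refl) p'))

  shared-∷ʳ-∉ : ∀ {a} X B → a ∉ B → shared B (a ∷ X) ≡ shared B X
  shared-∷ʳ-∉ X B a∉B = shared-cong B (_ ∷ X) X
    (λ { e∈B (here refl) → ⊥-elim (a∉B e∈B) ; _ (there p) → p }) (λ _ → there)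

  shared-∷ʳ-∈ : ∀ {a} X B → Unique B → a ∈ B → a ∉ X → shared B (a ∷ X) ≡ suc (shared B X)
  shared-∷ʳ-∈ X (b ∷ B) uB (here refl) a∉X = begin
    shared (b ∷ B) (b ∷ X) ≡⟨ shared-∷ˡ-∈ {X = B} (here refl) ⟩
    suc (shared B (b ∷ X)) ≡⟨ cong suc (shared-∷ʳ-∉ X B (Unique[x∷xs]⇒x∉xs uB)) ⟩
    suc (shared B X)       ≡⟨ cong suc (shared-∷ˡ-∉ {X = B} a∉X) ⟨
    suc (shared (b ∷ B) X) ∎
    where open ≡-Reasoning
  shared-∷ʳ-∈ {a} X (b ∷ B) uB (there a∈B) a∉X = by-cases (b ∈? X)
    where
    open ≡-Reasoning
    ih : shared B (a ∷ X) ≡ suc (shared B X)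
    ih = shared-∷ʳ-∈ X B (unique-tail uB) a∈B a∉X
    by-cases : Dec (b ∈ X) → shared (b ∷ B) (a ∷ X) ≡ suc (shared (b ∷ B) X)
    by-cases (yes b∈X) = begin
      shared (b ∷ B) (a ∷ X) ≡⟨ shared-∷ˡ-∈ {X = B} (there b∈X) ⟩
      suc (shared B (a ∷ X)) ≡⟨ cong suc ih ⟩
      suc (suc (shared B X)) ≡⟨ cong suc (shared-∷ˡ-∈ {X = B} b∈X) ⟨
      suc (shared (b ∷ B) X) ∎
    by-cases (no b∉X) = begin
      shared (b ∷ B) (a ∷ X) ≡⟨ shared-∷ˡ-∉ {X = B} b∉a∷X ⟩
      shared B (a ∷ X)       ≡⟨ ih ⟩
      suc (shared B X)       ≡⟨ cong suc (shared-∷ˡ-∉ {X = B} b∉X) ⟨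
      suc (shared (b ∷ B) X) ∎
      where
      b∉a∷X : b ∉ a ∷ X
      b∉a∷X (here refl) = Unique[x∷xs]⇒x∉xs uB a∈B
      b∉a∷X (there p)   = b∉X p

  shared-comm : ∀ X B → Unique X → Unique B → shared X B ≡ shared B X
  shared-comm []      B _  _  = sym (cong length (List.filter-none (_∈? []) {B} (All.tabulate λ _ ())))
  shared-comm (a ∷ X) B uX uB with a ∈? B
  ... | yes a∈B = trans (cong suc (shared-comm X B (unique-tail uX) uB))
                        (sym (shared-∷ʳ-∈ X B uB a∈B (Unique[x∷xs]⇒x∉xs uX)))
  ... | no a∉B  = trans (shared-comm X B (unique-tail uX) uB) (sym (shared-∷ʳ-∉ X B a∉B))

  shared-one-missing : ∀ {e} X B → Unique X → e ∈ X → e ∉ B →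
                        (∀ {e'} → e' ∈ X → e' ≢ e → e' ∈ B) → suc (shared X B) ≡ length X
  shared-one-missing (a ∷ X) B u (here refl) a∉B others = begin
    suc (shared (a ∷ X) B) ≡⟨ cong suc (shared-∷ˡ-∉ {X = X} a∉B) ⟩
    suc (shared X B)       ≡⟨ cong suc (shared-⊆ X B λ p → others (there p) (a≢ p)) ⟩
    suc (length X)         ∎
    where
    open ≡-Reasoning
    a≢ : ∀ {e'} → e' ∈ X → e' ≢ a
    a≢ p refl = Unique[x∷xs]⇒x∉xs u p
  shared-one-missing (a ∷ X) B u (there e∈X) e∉B others = begin
    suc (shared (a ∷ X) B) ≡⟨ cong suc (shared-∷ˡ-∈ {X = X} (others (here refl) a≢e)) ⟩
    suc (suc (shared X B)) ≡⟨ cong suc (shared-one-missing X B (unique-tail u) e∈X e∉B (others ∘ there)) ⟩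
    suc (length X)         ∎
    where
    open ≡-Reasoning
    a≢e : a ≢ _
    a≢e refl = Unique[x∷xs]⇒x∉xs u e∈X

  shared-two-missing : ∀ {e₁ e₂} X B → e₁ ∈ X → e₂ ∈ X → e₁ ≢ e₂ → e₁ ∉ B → e₂ ∉ B →
                        suc (suc (shared X B)) ≤ length X
  shared-two-missing (a ∷ X) B (here refl) (here refl) e₁≢e₂ _ _ = ⊥-elim (e₁≢e₂ refl)
  shared-two-missing (a ∷ X) B (here refl) (there p₂) _ e₁∉B e₂∉B
    rewrite shared-∷ˡ-∉ {X = X} e₁∉B =
      s≤s (List.filter-notAll (_∈? B) X (Any.map (λ { refl → e₂∉B }) p₂))
  shared-two-missing (a ∷ X) B (there p₁) (here refl) _ e₁∉B e₂∉B
    rewrite shared-∷ˡ-∉ {X = X} e₂∉B =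
      s≤s (List.filter-notAll (_∈? B) X (Any.map (λ { refl → e₁∉B }) p₁))
  shared-two-missing (a ∷ X) B (there p₁) (there p₂) e₁≢e₂ e₁∉B e₂∉B with a ∈? B
  ... | yes _ = s≤s (shared-two-missing X B p₁ p₂ e₁≢e₂ e₁∉B e₂∉B)
  ... | no _  = ℕ.m≤n⇒m≤1+n (shared-two-missing X B p₁ p₂ e₁≢e₂ e₁∉B e₂∉B)

-- Shuffle words

module _ {m n : ℕ} where
  private
    Ltr = Letter m n
    Wrd = Word m n
    Elt = Elem m n

  Ordered : Wrd → Set
  Ordered = AllPairs (λ a b → ¬ MustPrecede b a)

  isShuf⇒ordered : ∀ {w} → IsShuf w → Ordered w
  isShuf⇒ordered {w} (_ , ord) = go w ord
    where
    go : ∀ (w : Wrd) → (∀ p q → MustPrecede (lookup w p) (lookup w q) → p <ᶠ q) →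
         Ordered w
    go []      _   = []
    go (a ∷ w) ord = All.tabulate head-first ∷ go w λ p q → s<s⁻¹ ∘ ord (fsuc p) (fsuc q)
      where
      head-first : ∀ {b} → b ∈ w → ¬ MustPrecede b a
      head-first b∈w b≺a =
        ℕ.n≮0 (ord (fsuc (Any.index b∈w)) fzero (subst (λ c → MustPrecede c a) (lookup-index b∈w) b≺a))

  mustPrecede-irrefl : ∀ (a : Ltr) → ¬ MustPrecede a a
  mustPrecede-irrefl (x i) = ℕ.<-irrefl refl
  mustPrecede-irrefl (y j) = ℕ.<-irrefl refl

  unique∧ordered⇒isShuf : ∀ {w} → Unique w → Ordered w → IsShuf w
  unique∧ordered⇒isShuf {w} u ord = u , go w ord
    where
    go : ∀ (w : Wrd) → Ordered w →
         ∀ p q → MustPrecede (lookup w p) (lookup w q) → p <ᶠ q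
    go (a ∷ w) _           fzero    fzero    a≺a = ⊥-elim (mustPrecede-irrefl a a≺a)
    go (a ∷ w) _           fzero    (fsuc q) _   = s≤s z≤n
    go (a ∷ w) (ord ∷ _)   (fsuc p) fzero    b≺a = ⊥-elim (All.lookup ord (∈-lookup p) b≺a)
    go (a ∷ w) (_ ∷ ords)  (fsuc p) (fsuc q) ≺   = s≤s (go w ords p q ≺)

  ordered-before : ∀ {a b w} → Ordered w → Before a b w → ¬ MustPrecede b a
  ordered-before (ord ∷ _)  (before-here b∈w) = All.lookup ord b∈w
  ordered-before (_ ∷ ords) (before-there r)  = ordered-before ords r

  ordered-after : ∀ (a : Wrd) {c b z} → IsShuf (a ++ c ∷ b) → z ∈ b → ¬ MustPrecede z c
  ordered-after a s z∈b = ordered-before (isShuf⇒ordered s) (before-++ˡ a (before-here z∈b))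

  Comparable : Ltr → Ltr → Set
  Comparable a b = MustPrecede a b ⊎ MustPrecede b a

  comparable-x : ∀ {i k} → i ≢ k → Comparable (x i) (x k)
  comparable-x {i} {k} i≢k with Fin.<-cmp i k
  ... | tri< i<k _ _ = inj₁ i<k
  ... | tri≈ _ i≡k _ = ⊥-elim (i≢k i≡k)
  ... | tri> _ _ k<i = inj₂ k<i

  comparable-y : ∀ {j l} → j ≢ l → Comparable (y j) (y l)
  comparable-y {j} {l} j≢l with Fin.<-cmp j l
  ... | tri< j<l _ _ = inj₁ j<l
  ... | tri≈ _ j≡l _ = ⊥-elim (j≢l j≡l)
  ... | tri> _ _ l<j = inj₂ l<j

  before⇒mustPrecede : ∀ {a b w} → IsShuf w → Before a b w → Comparable a b → MustPrecede a b
  before⇒mustPrecede s r = [ id , ⊥-elim ∘ ordered-before (isShuf⇒ordered s) r ]′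

  before-comparable : ∀ {a b u w} → IsShuf u → IsShuf w → Before a b u → a ∈ w → b ∈ w →
                      Comparable a b → Before a b w
  before-comparable {w = w} su sw r a∈w b∈w cmp
    with before-total w a∈w b∈w (λ { refl → before-irrefl (proj₁ su) r })
  ... | inj₁ r' = r'
  ... | inj₂ r' = ⊥-elim ([ ordered-before (isShuf⇒ordered sw) r' , ordered-before (isShuf⇒ordered su) r ]′ cmp)

  isShuf-swap : ∀ (a : Wrd) {c d b} → IsShuf (a ++ c ∷ d ∷ b) → d ≢ c → ¬ MustPrecede c d →
                IsShuf (a ++ d ∷ c ∷ b)
  isShuf-swap a s d≢c c⊀d =
    unique∧ordered⇒isShuf (allPairs-swap a (proj₁ s) d≢c) (allPairs-swap a (isShuf⇒ordered s) c⊀d)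

-- Facets

  loop : Ltr → Elt
  loop (x i) = loopX i
  loop (y j) = loopY j

  loop-injective : ∀ {a b} → loop a ≡ loop b → a ≡ b
  loop-injective {x _} {x _} refl = refl
  loop-injective {y _} {y _} refl = refl

  loop≢edge : ∀ z {a b} → loop z ≢ edge a b
  loop≢edge (x _) ()
  loop≢edge (y _) ()

  edge-injectiveˡ : ∀ {a b c d} → edge {m} {n} a b ≡ edge c d → a ≡ c
  edge-injectiveˡ refl = refl

  edge-injectiveʳ : ∀ {a b c d} → edge {m} {n} a b ≡ edge c d → b ≡ d
  edge-injectiveʳ refl = refl

  lastX : Fin (suc m) → Wrd → Fin (suc m)
  lastX lx []        = lx
  lastX lx (x i ∷ w) = lastX (fsuc i) w
  lastX lx (y _ ∷ w) = lastX lx w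

  lastY : Fin (suc n) → Wrd → Fin (suc n)
  lastY ly []        = ly
  lastY ly (x _ ∷ w) = lastY ly w
  lastY ly (y j ∷ w) = lastY (fsuc j) w

  edgesFrom-++ : ∀ lx ly (p q : Wrd) →
                 edgesFrom lx ly (p ++ q) ≡ edgesFrom lx ly p ++ edgesFrom (lastX lx p) (lastY ly p) q
  edgesFrom-++ lx ly []        q = refl
  edgesFrom-++ lx ly (x i ∷ p) q = cong (edge (fsuc i) ly ∷_) (edgesFrom-++ (fsuc i) ly p q)
  edgesFrom-++ lx ly (y j ∷ p) q = cong (edge lx (fsuc j) ∷_) (edgesFrom-++ lx (fsuc j) p q)

  lastX-++ : ∀ lx (p q : Wrd) → lastX lx (p ++ q) ≡ lastX (lastX lx p) q
  lastX-++ lx []        q = refl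
  lastX-++ lx (x i ∷ p) q = lastX-++ (fsuc i) p q
  lastX-++ lx (y _ ∷ p) q = lastX-++ lx p q

  lastY-++ : ∀ ly (p q : Wrd) → lastY ly (p ++ q) ≡ lastY (lastY ly p) q
  lastY-++ ly []        q = refl
  lastY-++ ly (x _ ∷ p) q = lastY-++ ly p q
  lastY-++ ly (y j ∷ p) q = lastY-++ (fsuc j) p q

  XIndex : Wrd → Fin (suc m) → Set
  XIndex w a = ∃ λ k → a ≡ fsuc k × x k ∈ w

  YIndex : Wrd → Fin (suc n) → Set
  YIndex w b = ∃ λ k → b ≡ fsuc k × y k ∈ w

  XSeen : Fin (suc m) → Wrd → Fin (suc m) → Set
  XSeen lx w a = a ≡ lx ⊎ XIndex w a

  YSeen : Fin (suc n) → Wrd → Fin (suc n) → Set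
  YSeen ly w b = b ≡ ly ⊎ YIndex w b

  private
    xIndex-there : ∀ {w l a} → XIndex w a → XIndex (l ∷ w) a
    xIndex-there (k , a≡ , p) = k , a≡ , there p

    yIndex-there : ∀ {w l b} → YIndex w b → YIndex (l ∷ w) b
    yIndex-there (k , b≡ , p) = k , b≡ , there p

    xSeen-there : ∀ {lx w l a} → XSeen lx w a → XSeen lx (l ∷ w) a
    xSeen-there = Sum.map₂ xIndex-there

    ySeen-there : ∀ {ly w l b} → YSeen ly w b → YSeen ly (l ∷ w) b
    ySeen-there = Sum.map₂ yIndex-there

  ∈-edgesFrom⁻ : ∀ lx ly w {e} → e ∈ edgesFrom lx ly w →
                 ∃ λ a → ∃ λ b → e ≡ edge a b × XSeen lx w a × YSeen ly w b × (XIndex w a ⊎ YIndex w b)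
  ∈-edgesFrom⁻ lx ly (x i ∷ w) (here refl) =
    _ , _ , refl , inj₂ (i , refl , here refl) , inj₁ refl , inj₁ (i , refl , here refl)
  ∈-edgesFrom⁻ lx ly (y j ∷ w) (here refl) =
    _ , _ , refl , inj₁ refl , inj₂ (j , refl , here refl) , inj₂ (j , refl , here refl)
  ∈-edgesFrom⁻ lx ly (x i ∷ w) (there p) with ∈-edgesFrom⁻ (fsuc i) ly w p
  ... | a , b , e≡ , sa , sb , ia =
    a , b , e≡ , [ (λ { refl → inj₂ (i , refl , here refl) }) , inj₂ ∘ xIndex-there ]′ sa ,
    ySeen-there sb , Sum.map xIndex-there yIndex-there ia
  ∈-edgesFrom⁻ lx ly (y j ∷ w) (there p) with ∈-edgesFrom⁻ lx (fsuc j) w p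
  ... | a , b , e≡ , sa , sb , ia =
    a , b , e≡ , xSeen-there sa , [ (λ { refl → inj₂ (j , refl , here refl) }) , inj₂ ∘ yIndex-there ]′ sb ,
    Sum.map xIndex-there yIndex-there ia

  edge∉edgesFrom-x : ∀ {lx ly w a b} → ¬ XSeen lx w a → edge a b ∉ edgesFrom lx ly w
  edge∉edgesFrom-x {lx} {ly} {w} ¬sa p with ∈-edgesFrom⁻ lx ly w p
  ... | _ , _ , refl , sa , _ = ¬sa sa

  edge∉edgesFrom-y : ∀ {lx ly w a b} → ¬ YSeen ly w b → edge a b ∉ edgesFrom lx ly w
  edge∉edgesFrom-y {lx} {ly} {w} ¬sb p with ∈-edgesFrom⁻ lx ly w p
  ... | _ , _ , refl , _ , sb , _ = ¬sb sb

  edge∉edgesFrom-xy : ∀ {lx ly w a b} → ¬ XIndex w a → ¬ YIndex w b → edge a b ∉ edgesFrom lx ly w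
  edge∉edgesFrom-xy {lx} {ly} {w} ¬ia ¬ib p with ∈-edgesFrom⁻ lx ly w p
  ... | _ , _ , refl , _ , _ , ia = [ ¬ia , ¬ib ]′ ia

  loop∉edgesFrom : ∀ {lx ly w} z → loop z ∉ edgesFrom lx ly w
  loop∉edgesFrom {lx} {ly} {w} z p with ∈-edgesFrom⁻ lx ly w p
  ... | _ , _ , e≡ , _ = loop≢edge z e≡

  lastX-seen : ∀ lx w → XSeen lx w (lastX lx w)
  lastX-seen lx []        = inj₁ refl
  lastX-seen lx (x i ∷ w) =
    [ (λ e → inj₂ (i , e , here refl)) , inj₂ ∘ xIndex-there ]′ (lastX-seen (fsuc i) w)
  lastX-seen lx (y _ ∷ w) = xSeen-there (lastX-seen lx w)

  lastY-seen : ∀ ly w → YSeen ly w (lastY ly w)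
  lastY-seen ly []        = inj₁ refl
  lastY-seen ly (x _ ∷ w) = ySeen-there (lastY-seen ly w)
  lastY-seen ly (y j ∷ w) =
    [ (λ e → inj₂ (j , e , here refl)) , inj₂ ∘ yIndex-there ]′ (lastY-seen (fsuc j) w)

  edgesFrom-unique : ∀ lx ly (w : Wrd) → Unique w → ¬ XIndex w lx → ¬ YIndex w ly →
                     Unique (edgesFrom lx ly w)
  edgesFrom-unique lx ly []        _ _   _   = []
  edgesFrom-unique lx ly (x i ∷ w) u ¬ix ¬iy =
    ¬Any⇒All¬ _ (edge∉edgesFrom-xy ¬ix' ¬iy') ∷ edgesFrom-unique (fsuc i) ly w (unique-tail u) ¬ix' ¬iy'
    where
    ¬ix' : ¬ XIndex w (fsuc i)
    ¬ix' (_ , refl , p) = Unique[x∷xs]⇒x∉xs u p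
    ¬iy' : ¬ YIndex w ly
    ¬iy' = ¬iy ∘ yIndex-there
  edgesFrom-unique lx ly (y j ∷ w) u ¬ix ¬iy =
    ¬Any⇒All¬ _ (edge∉edgesFrom-xy ¬ix' ¬iy') ∷ edgesFrom-unique lx (fsuc j) w (unique-tail u) ¬ix' ¬iy'
    where
    ¬ix' : ¬ XIndex w lx
    ¬ix' = ¬ix ∘ xIndex-there
    ¬iy' : ¬ YIndex w (fsuc j)
    ¬iy' (_ , refl , p) = Unique[x∷xs]⇒x∉xs u p

  length-edgesFrom : ∀ lx ly (w : Wrd) → length (edgesFrom lx ly w) ≡ length w
  length-edgesFrom lx ly []        = refl
  length-edgesFrom lx ly (x _ ∷ w) = cong suc (length-edgesFrom _ _ w)
  length-edgesFrom lx ly (y _ ∷ w) = cong suc (length-edgesFrom _ _ w)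

  loops : Wrd → List Elt
  loops w = concatMap (missing w) (allLetters m n)

  ∈-missing⁻ : ∀ (w : Wrd) l {e} → e ∈ missing w l → e ≡ loop l × l ∉ w
  ∈-missing⁻ w (x i) p with DecMembership._∈?_ _≟L_ (x i) w
  ∈-missing⁻ w (x i) (here refl) | no x∉w = refl , x∉w
  ∈-missing⁻ w (y j) p with DecMembership._∈?_ _≟L_ (y j) w
  ∈-missing⁻ w (y j) (here refl) | no y∉w = refl , y∉w

  loop∈missing : ∀ (w : Wrd) l → l ∉ w → loop l ∈ missing w l
  loop∈missing w (x i) l∉w with DecMembership._∈?_ _≟L_ (x i) w
  ... | yes l∈w = ⊥-elim (l∉w l∈w)
  ... | no _    = here refl
  loop∈missing w (y j) l∉w with DecMembership._∈?_ _≟L_ (y j) w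
  ... | yes l∈w = ⊥-elim (l∉w l∈w)
  ... | no _    = here refl

  missing-unique : ∀ (w : Wrd) l → Unique (missing w l)
  missing-unique w (x i) with DecMembership._∈?_ _≟L_ (x i) w
  ... | yes _ = []
  ... | no _  = [] ∷ []
  missing-unique w (y j) with DecMembership._∈?_ _≟L_ (y j) w
  ... | yes _ = []
  ... | no _  = [] ∷ []

  ∈-concatMap-missing⁻ : ∀ (w : Wrd) L {e} → e ∈ concatMap (missing w) L →
                         ∃ λ l → l ∈ L × e ≡ loop l × l ∉ w
  ∈-concatMap-missing⁻ w (l ∷ L) p with ∈-++⁻ (missing w l) p
  ... | inj₁ q = l , here refl , ∈-missing⁻ w l q
  ... | inj₂ q with ∈-concatMap-missing⁻ w L q
  ...   | l' , l'∈L , rest = l' , there l'∈L , rest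

  loop∈concatMap-missing : ∀ (w : Wrd) {L z} → z ∈ L → z ∉ w → loop z ∈ concatMap (missing w) L
  loop∈concatMap-missing w {l ∷ L} (here refl) z∉w = ∈-++⁺ˡ (loop∈missing w l z∉w)
  loop∈concatMap-missing w {l ∷ L} (there p)   z∉w = ∈-++⁺ʳ (missing w l) (loop∈concatMap-missing w p z∉w)

  concatMap-missing-unique : ∀ (w : Wrd) L → Unique L → Unique (concatMap (missing w) L)
  concatMap-missing-unique w []      _ = []
  concatMap-missing-unique w (l ∷ L) u =
    unique-++⁺ (missing-unique w l) (concatMap-missing-unique w L (unique-tail u)) λ (p , q) → disjoint p q
    where
    disjoint : ∀ {e} → e ∈ missing w l → e ∉ concatMap (missing w) L
    disjoint p q with ∈-missing⁻ w l p | ∈-concatMap-missing⁻ w L q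
    ... | refl , _ | l' , l'∈L , e≡ , _ with loop-injective e≡
    ...   | refl = Unique[x∷xs]⇒x∉xs u l'∈L

  ∈-allLetters : ∀ z → z ∈ allLetters m n
  ∈-allLetters (x i) = ∈-++⁺ˡ (∈-map⁺ x (∈-allFin i))
  ∈-allLetters (y j) = ∈-++⁺ʳ (map x (allFin m)) (∈-map⁺ y (∈-allFin j))

  allLetters-unique : Unique (allLetters m n)
  allLetters-unique =
    unique-++⁺ (unique-map⁺ x-inj (unique-allFin m)) (unique-map⁺ y-inj (unique-allFin n))
               λ (p , q) → disjoint (∈-map⁻ x p) (∈-map⁻ y q)
    where
    disjoint : ∀ {v : Ltr} → (∃ λ i → i ∈ allFin m × v ≡ x i) →
               ¬ (∃ λ j → j ∈ allFin n × v ≡ y j)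
    disjoint (_ , _ , refl) (_ , _ , ())

  length-allLetters : length (allLetters m n) ≡ m + n
  length-allLetters = begin
    length (map x (allFin m) ++ map y (allFin n))
      ≡⟨ List.length-++ (map x (allFin m)) ⟩
    length (map x (allFin m)) + length (map y (allFin n))
      ≡⟨ cong₂ _+_ (List.length-map x (allFin m)) (List.length-map y (allFin n)) ⟩
    length (allFin m) + length (allFin n)
      ≡⟨ cong₂ _+_ (List.length-tabulate {n = m} id) (List.length-tabulate {n = n} id) ⟩
    m + n
      ∎
    where open ≡-Reasoning

  loop∈F : ∀ {w : Wrd} z → z ∉ w → loop z ∈ F w
  loop∈F {w} z z∉w = ∈-++⁺ˡ (loop∈concatMap-missing w (∈-allLetters z) z∉w)

  ∈-F⁻ : ∀ (w : Wrd) {e} → e ∈ F w → (∃ λ z → e ≡ loop z × z ∉ w) ⊎ e ∈ edgesFrom fzero fzero w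
  ∈-F⁻ w p with ∈-++⁻ (loops w) p
  ... | inj₁ q with ∈-concatMap-missing⁻ w (allLetters m n) q
  ...   | l , _ , rest = inj₁ (l , rest)
  ∈-F⁻ w p | inj₂ q = inj₂ q

  loop∉F : ∀ {w : Wrd} {z} → z ∈ w → loop z ∉ F w
  loop∉F {w} z∈w p with ∈-F⁻ w p
  ... | inj₁ (_ , e≡ , z'∉w) with loop-injective e≡
  ...   | refl = z'∉w z∈w
  loop∉F {w} {z} _ p | inj₂ q = loop∉edgesFrom z q

  edge∈F : ∀ {w : Wrd} {e} → e ∈ edgesFrom fzero fzero w → e ∈ F w
  edge∈F {w} p = ∈-++⁺ʳ (loops w) p

  edge∉F : ∀ (w : Wrd) {a b} → edge a b ∉ edgesFrom fzero fzero w → edge a b ∉ F w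
  edge∉F w e∉ p with ∈-F⁻ w p
  ... | inj₁ (z , e≡ , _) = loop≢edge z (sym e≡)
  ... | inj₂ q = e∉ q

  F-unique : ∀ (w : Wrd) → Unique w → Unique (F w)
  F-unique w u =
    unique-++⁺ (concatMap-missing-unique w (allLetters m n) allLetters-unique)
               (edgesFrom-unique fzero fzero w u (λ { (_ , () , _) }) (λ { (_ , () , _) }))
               λ (p , q) → disjoint p q
    where
    disjoint : ∀ {e} → e ∈ loops w → e ∉ edgesFrom fzero fzero w
    disjoint p with ∈-concatMap-missing⁻ w (allLetters m n) p
    ... | z , _ , refl , _ = loop∉edgesFrom z

  module SharedLetters = Shared (_≟L_ {m} {n})
  open Shared (_≟E_ {m} {n}) public

  -- Every letter contributes exactly one element to F w: its loop if absent, its edge if present.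
  length-F : ∀ (w : Wrd) → Unique w → length (F w) ≡ m + n
  length-F w u = begin
    length (loops w ++ edgesFrom fzero fzero w)
      ≡⟨ List.length-++ (loops w) ⟩
    #loops + length (edgesFrom fzero fzero w)
      ≡⟨ cong (_+_ #loops) (length-edgesFrom fzero fzero w) ⟩
    #loops + length w
      ≡⟨ cong (_+_ #loops) (SharedLetters.shared-⊆ w (allLetters m n) (λ {z} _ → ∈-allLetters z)) ⟨
    #loops + SharedLetters.shared w (allLetters m n)
      ≡⟨ cong (_+_ #loops) (SharedLetters.shared-comm w (allLetters m n) u allLetters-unique) ⟩
    #loops + SharedLetters.shared (allLetters m n) w
      ≡⟨ missing+present (allLetters m n) ⟩
    length (allLetters m n)
      ≡⟨ length-allLetters ⟩
    m + n
      ∎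
    where
    open ≡-Reasoning
    #loops = length (loops w)
    missing+present : ∀ L → length (concatMap (missing w) L) + SharedLetters.shared L w ≡ length L
    missing+present []      = refl
    missing+present (x i ∷ L) with DecMembership._∈?_ _≟L_ (x i) w
    ... | yes _ = trans (ℕ.+-suc _ _) (cong suc (missing+present L))
    ... | no _  = cong suc (missing+present L)
    missing+present (y j ∷ L) with DecMembership._∈?_ _≟L_ (y j) w
    ... | yes _ = trans (ℕ.+-suc _ _) (cong suc (missing+present L))
    ... | no _  = cong suc (missing+present L)

  lastX₀ : Wrd → Fin (suc m)
  lastX₀ = lastX fzero

  lastY₀ : Wrd → Fin (suc n)
  lastY₀ = lastY fzero

  lastX₀-fresh : ∀ (a : Wrd) {c k} → Unique (a ++ c) → lastX₀ a ≡ fsuc k → x k ∉ c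
  lastX₀-fresh a u last≡ with lastX-seen fzero a
  ... | inj₁ last≡0 with trans (sym last≡0) last≡
  ...   | ()
  lastX₀-fresh a u last≡ | inj₂ (_ , last≡' , x∈a) with trans (sym last≡) last≡'
  ...   | refl = unique-++-disjoint a u x∈a

  lastY₀-fresh : ∀ (a : Wrd) {c k} → Unique (a ++ c) → lastY₀ a ≡ fsuc k → y k ∉ c
  lastY₀-fresh a u last≡ with lastY-seen fzero a
  ... | inj₁ last≡0 with trans (sym last≡0) last≡
  ...   | ()
  lastY₀-fresh a u last≡ | inj₂ (_ , last≡' , y∈a) with trans (sym last≡) last≡'
  ...   | refl = unique-++-disjoint a u y∈a

  ∈-F-++ˡ : ∀ (a q : Wrd) {e} → e ∈ edgesFrom fzero fzero a → e ∈ F (a ++ q)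
  ∈-F-++ˡ a q p = edge∈F (subst (_ ∈_) (sym (edgesFrom-++ fzero fzero a q)) (∈-++⁺ˡ p))

  ∈-F-++ʳ : ∀ (a q : Wrd) {e} → e ∈ edgesFrom (lastX₀ a) (lastY₀ a) q → e ∈ F (a ++ q)
  ∈-F-++ʳ a q p = edge∈F (subst (_ ∈_) (sym (edgesFrom-++ fzero fzero a q)) (∈-++⁺ʳ _ p))

  ∈-edgesFrom-++⁻ : ∀ (a q : Wrd) {e} → e ∈ edgesFrom fzero fzero (a ++ q) →
                    e ∈ edgesFrom fzero fzero a ⊎ e ∈ edgesFrom (lastX₀ a) (lastY₀ a) q
  ∈-edgesFrom-++⁻ a q p = ∈-++⁻ _ (subst (_ ∈_) (edgesFrom-++ fzero fzero a q) p)

  edge∉F-++ : ∀ (a q : Wrd) {c d} → edge c d ∉ edgesFrom fzero fzero a →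
              edge c d ∉ edgesFrom (lastX₀ a) (lastY₀ a) q → edge c d ∉ F (a ++ q)
  edge∉F-++ a q ∉a ∉q = edge∉F (a ++ q) λ p → [ ∉a , ∉q ]′ (∈-edgesFrom-++⁻ a q p)

  ¬xSeen : ∀ {lx} {w : Wrd} {a} → a ≢ lx → (∀ {k} → a ≡ fsuc k → x k ∉ w) → ¬ XSeen lx w a
  ¬xSeen a≢lx _   (inj₁ a≡lx)         = a≢lx a≡lx
  ¬xSeen _    x∉w (inj₂ (_ , a≡ , p)) = x∉w a≡ p

  ¬ySeen : ∀ {ly} {w : Wrd} {b} → b ≢ ly → (∀ {k} → b ≡ fsuc k → y k ∉ w) → ¬ YSeen ly w b
  ¬ySeen b≢ly _   (inj₁ b≡ly)         = b≢ly b≡ly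
  ¬ySeen _    y∉w (inj₂ (_ , b≡ , p)) = y∉w b≡ p

  edge∉F-absentX : ∀ (w : Wrd) {i b} → x i ∉ w → edge (fsuc i) b ∉ F w
  edge∉F-absentX w x∉w = edge∉F w (edge∉edgesFrom-x (¬xSeen (λ ()) λ { refl → x∉w }))

  edge∉F-absentY : ∀ (w : Wrd) {a j} → y j ∉ w → edge a (fsuc j) ∉ F w
  edge∉F-absentY w y∉w = edge∉F w (edge∉edgesFrom-y (¬ySeen (λ ()) λ { refl → y∉w }))

  -- In Q y_j V the letter y_j separates the y-letters of Q from every later x.
  edge∉F-x-after-y : ∀ (Q : Wrd) j V {i} → Unique (Q ++ y j ∷ V) → x i ∉ Q →
                     edge (fsuc i) (lastY₀ Q) ∉ F (Q ++ y j ∷ V)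
  edge∉F-x-after-y Q j V u x∉Q = edge∉F-++ Q (y j ∷ V)
    (edge∉edgesFrom-x (¬xSeen (λ ()) λ { refl → x∉Q }))
    λ { (here e≡) → last≢ (edge-injectiveʳ e≡)
      ; (there p) → edge∉edgesFrom-y (¬ySeen last≢ λ last≡ q → lastY₀-fresh Q u last≡ (there q)) p }
    where
    last≢ : lastY₀ Q ≢ fsuc j
    last≢ last≡ = lastY₀-fresh Q u last≡ (here refl)

  edge∉F-y-after-x : ∀ (Q : Wrd) i U {j} → Unique (Q ++ x i ∷ U) → y j ∉ Q →
                     edge (lastX₀ Q) (fsuc j) ∉ F (Q ++ x i ∷ U)
  edge∉F-y-after-x Q i U u y∉Q = edge∉F-++ Q (x i ∷ U)
    (edge∉edgesFrom-y (¬ySeen (λ ()) λ { refl → y∉Q }))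
    λ { (here e≡) → last≢ (edge-injectiveˡ e≡)
      ; (there p) → edge∉edgesFrom-x (¬xSeen last≢ λ last≡ q → lastX₀-fresh Q u last≡ (there q)) p }
    where
    last≢ : lastX₀ Q ≢ fsuc i
    last≢ last≡ = lastX₀-fresh Q u last≡ (here refl)

-- Cover moves and their facets

  HeadNotY : Wrd → Set
  HeadNotY (y _ ∷ _) = ⊥
  HeadNotY _         = ⊤

  HeadNotX : Wrd → Set
  HeadNotX (x _ ∷ _) = ⊥
  HeadNotX _         = ⊤

  data CoverMove : Wrd → Wrd → Set where
    cover-delete : ∀ a i b → HeadNotY b → CoverMove (a ++ x i ∷ b) (a ++ b)
    cover-insert : ∀ a j b → HeadNotX b → CoverMove (a ++ b) (a ++ y j ∷ b)
    cover-swap   : ∀ a i j b → CoverMove (a ++ x i ∷ y j ∷ b) (a ++ y j ∷ x i ∷ b)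

  coverMove⇒move : ∀ {u v} → CoverMove u v → Move u v
  coverMove⇒move (cover-delete a i b _) = delete-x a b i
  coverMove⇒move (cover-insert a j b _) = insert-y a b j
  coverMove⇒move (cover-swap a i j b)   = swap-xy a b i j

  edgesFrom-headNotY : ∀ {lx lx' ly} (b : Wrd) → HeadNotY b → edgesFrom lx ly b ≡ edgesFrom lx' ly b
  edgesFrom-headNotY []        _ = refl
  edgesFrom-headNotY (x _ ∷ _) _ = refl

  edgesFrom-headNotX : ∀ {lx ly ly'} (b : Wrd) → HeadNotX b → edgesFrom lx ly b ≡ edgesFrom lx ly' b
  edgesFrom-headNotX []        _ = refl
  edgesFrom-headNotX (y _ ∷ _) _ = refl

  Adjacent : Wrd → Wrd → Set
  Adjacent u v = suc (shared (F u) (F v)) ≡ m + n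

  lone-difference⇒adjacent : ∀ {u v : Wrd} {e} → Unique u → e ∈ F u → e ∉ F v →
                             (∀ {e'} → e' ∈ F u → e' ≢ e → e' ∈ F v) → Adjacent u v
  lone-difference⇒adjacent {u} {v} uu e∈ e∉ others =
    trans (shared-one-missing (F u) (F v) (F-unique u uu) e∈ e∉ others) (length-F u uu)

  delete-adjacent : ∀ a i b → HeadNotY b → Unique (a ++ x i ∷ b) → Adjacent (a ++ x i ∷ b) (a ++ b)
  delete-adjacent a i b notY uu =
    lone-difference⇒adjacent uu (∈-F-++ʳ a (x i ∷ b) (here refl)) (edge∉F-absentX (a ++ b) x∉) others
    where
    x∉ : x i ∉ a ++ b
    x∉ = ∉-++ a (proj₁ (unique-insert⁻ a uu)) (proj₂ (unique-insert⁻ a uu))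
    others : ∀ {e'} → e' ∈ F (a ++ x i ∷ b) → e' ≢ edge (fsuc i) (lastY₀ a) → e' ∈ F (a ++ b)
    others p e'≢ with ∈-F⁻ (a ++ x i ∷ b) p
    ... | inj₁ (z , refl , z∉) = loop∈F z (z∉ ∘ ∈-insert⁺ a)
    ... | inj₂ q with ∈-edgesFrom-++⁻ a (x i ∷ b) q
    ...   | inj₁ r           = ∈-F-++ˡ a b r
    ...   | inj₂ (here refl) = ⊥-elim (e'≢ refl)
    ...   | inj₂ (there r)   = ∈-F-++ʳ a b (subst (_ ∈_) (edgesFrom-headNotY b notY) r)

  insert-adjacent : ∀ a j b → HeadNotX b → Unique (a ++ y j ∷ b) → Adjacent (a ++ b) (a ++ y j ∷ b)
  insert-adjacent a j b notX uv =
    lone-difference⇒adjacent (unique-delete a uv) (loop∈F (y j) y∉) (loop∉F (∈-insert a)) others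
    where
    y∉ : y j ∉ a ++ b
    y∉ = ∉-++ a (proj₁ (unique-insert⁻ a uv)) (proj₂ (unique-insert⁻ a uv))
    others : ∀ {e'} → e' ∈ F (a ++ b) → e' ≢ loopY j → e' ∈ F (a ++ y j ∷ b)
    others p e'≢ with ∈-F⁻ (a ++ b) p
    ... | inj₁ (z , refl , z∉) = loop∈F z λ q → [ (λ { refl → e'≢ refl }) , z∉ ]′ (∈-insert⁻ a q)
    ... | inj₂ q with ∈-edgesFrom-++⁻ a b q
    ...   | inj₁ r = ∈-F-++ˡ a (y j ∷ b) r
    ...   | inj₂ r = ∈-F-++ʳ a (y j ∷ b) (there (subst (_ ∈_) (edgesFrom-headNotX b notX) r))

  swap-adjacent : ∀ a i j b → Unique (a ++ x i ∷ y j ∷ b) →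
                  Adjacent (a ++ x i ∷ y j ∷ b) (a ++ y j ∷ x i ∷ b)
  swap-adjacent a i j b uu =
    lone-difference⇒adjacent uu (∈-F-++ʳ a (x i ∷ y j ∷ b) (here refl))
      (edge∉F-x-after-y a j (x i ∷ b) (allPairs-swap a uu (λ ())) (proj₁ (unique-insert⁻ a uu))) others
    where
    others : ∀ {e'} → e' ∈ F (a ++ x i ∷ y j ∷ b) → e' ≢ edge (fsuc i) (lastY₀ a) →
             e' ∈ F (a ++ y j ∷ x i ∷ b)
    others p e'≢ with ∈-F⁻ (a ++ x i ∷ y j ∷ b) p
    ... | inj₁ (z , refl , z∉) = loop∈F z (z∉ ∘ ∈-swap a)
    ... | inj₂ q with ∈-edgesFrom-++⁻ a (x i ∷ y j ∷ b) q
    ...   | inj₁ r                   = ∈-F-++ˡ a (y j ∷ x i ∷ b) r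
    ...   | inj₂ (here refl)         = ⊥-elim (e'≢ refl)
    ...   | inj₂ (there (here refl)) = ∈-F-++ʳ a (y j ∷ x i ∷ b) (there (here refl))
    ...   | inj₂ (there (there r))   = ∈-F-++ʳ a (y j ∷ x i ∷ b) (there (there r))

-- Covers of the bubble lattice are exactly the cover moves

  move⇒≢ : ∀ {u v : Wrd} → Move u v → u ≢ v
  move⇒≢ (delete-x a b i) u≡v = ℕ.1+n≢n (trans (sym (length-insert a)) (cong length u≡v))
  move⇒≢ (insert-y a b j) u≡v = ℕ.1+n≢n (sym (trans (cong length u≡v) (length-insert a)))
  move⇒≢ (swap-xy a b i j) u≡v with List.++-cancelˡ a _ _ u≡v
  ... | ()

  ⋖⇒move : ∀ {u v : Shuf m n} → u ⋖ v → Move (proj₁ u) (proj₁ v)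
  ⋖⇒move ((ε , u≢v) , _) = ⊥-elim (u≢v refl)
  ⋖⇒move {u} {v} ((_◅_ {j = w} step rest , _) , nothing-between)
    with List.≡-dec _≟L_ (proj₁ w) (proj₁ v)
  ... | yes w≡v = subst (Move (proj₁ u)) w≡v step
  ... | no w≢v  = ⊥-elim (nothing-between (w , (step ◅ ε , move⇒≢ step) , (rest , w≢v)))

  private
    two-moves⇒¬⋖ : ∀ {u w v : Shuf m n} → Move (proj₁ u) (proj₁ w) → Move (proj₁ w) (proj₁ v) →
                   ¬ (Σ (Shuf m n) λ w → (u <Bub w) × (w <Bub v)) → ⊥
    two-moves⇒¬⋖ {w = w} s t nothing-between =
      nothing-between (w , (s ◅ ε , move⇒≢ s) , (t ◅ ε , move⇒≢ t))

    ++-∷-assoc : ∀ (a : Wrd) c r → (a ++ c ∷ []) ++ r ≡ a ++ c ∷ r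
    ++-∷-assoc a c r = List.++-assoc a (c ∷ []) r

  -- Deleting x before a y, or inserting y before an x, factors through the swap of that x and y.
  move⇒coverMove : ∀ (u : Wrd) (su : IsShuf u) (v : Wrd) (sv : IsShuf v) →
                   ¬ (Σ (Shuf m n) λ w → ((u , su) <Bub w) × (w <Bub (v , sv))) → Move u v → CoverMove u v
  move⇒coverMove _ su _ sv nothing-between (delete-x a (y j ∷ b) i) = ⊥-elim (two-moves⇒¬⋖
    {w = (a ++ y j ∷ x i ∷ b) , isShuf-swap a su (λ ()) (λ ())}
    (swap-xy a b i j)
    (subst₂ Move (++-∷-assoc a (y j) (x i ∷ b)) (++-∷-assoc a (y j) b) (delete-x (a ++ y j ∷ []) b i))
    nothing-between)
  move⇒coverMove _ su _ sv nothing-between (insert-y a (x i ∷ b) j) = ⊥-elim (two-moves⇒¬⋖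
    {w = (a ++ x i ∷ y j ∷ b) , isShuf-swap a sv (λ ()) (λ ())}
    (subst₂ Move (++-∷-assoc a (x i) b) (++-∷-assoc a (x i) (y j ∷ b)) (insert-y (a ++ x i ∷ []) b j))
    (swap-xy a b i j)
    nothing-between)
  move⇒coverMove _ _ _ _ _ (delete-x a []        i) = cover-delete a i [] tt
  move⇒coverMove _ _ _ _ _ (delete-x a (x k ∷ b) i) = cover-delete a i (x k ∷ b) tt
  move⇒coverMove _ _ _ _ _ (insert-y a []        j) = cover-insert a j [] tt
  move⇒coverMove _ _ _ _ _ (insert-y a (y k ∷ b) j) = cover-insert a j (y k ∷ b) tt
  move⇒coverMove _ _ _ _ _ (swap-xy a b i j)        = cover-swap a i j b

  ⋖⇒coverMove : ∀ {u v : Shuf m n} → u ⋖ v → CoverMove (proj₁ u) (proj₁ v)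
  ⋖⇒coverMove {u , su} {v , sv} u⋖v = move⇒coverMove u su v sv (proj₂ u⋖v) (⋖⇒move u⋖v)

  record Ascends (u w : Wrd) : Set where
    field
      x-shrink   : ∀ {i} → x i ∈ w → x i ∈ u
      y-grow     : ∀ {j} → y j ∈ u → y j ∈ w
      yx-persist : ∀ {i j} → Before (y j) (x i) u → x i ∈ w → Before (y j) (x i) w
  open Ascends

  ascends-refl : ∀ {u} → Ascends u u
  ascends-refl = record { x-shrink = id ; y-grow = id ; yx-persist = λ r _ → r }

  ascends-trans : ∀ {u v w} → Ascends u v → Ascends v w → Ascends u w
  ascends-trans r s = record
    { x-shrink   = x-shrink r ∘ x-shrink s
    ; y-grow     = y-grow s ∘ y-grow r
    ; yx-persist = λ p q → yx-persist s (yx-persist r p (x-shrink s q)) q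
    }

  move⇒ascends : ∀ {u w : Wrd} → Unique u → Move u w → Ascends u w
  move⇒ascends uu (delete-x a b i) = record
    { x-shrink   = ∈-insert⁺ a
    ; y-grow     = λ p → [ (λ ()) , id ]′ (∈-insert⁻ a p)
    ; yx-persist = λ r x∈ → before-delete a r (λ ()) λ { refl →
        ∉-++ a (proj₁ (unique-insert⁻ a uu)) (proj₂ (unique-insert⁻ a uu)) x∈ }
    }
  move⇒ascends uu (insert-y a b j) = record
    { x-shrink   = λ p → [ (λ ()) , id ]′ (∈-insert⁻ a p)
    ; y-grow     = ∈-insert⁺ a
    ; yx-persist = λ r _ → before-insert a r
    }
  move⇒ascends uu (swap-xy a b i j) = record
    { x-shrink   = ∈-swap a
    ; y-grow     = ∈-swap a
    ; yx-persist = λ r _ → before-swap a r (λ { (() , _) })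
    }

  ≤Bub⇒ascends : ∀ {u w : Shuf m n} → u ≤Bub w → Ascends (proj₁ u) (proj₁ w)
  ≤Bub⇒ascends ε                  = ascends-refl
  ≤Bub⇒ascends {u} (step ◅ steps) = ascends-trans (move⇒ascends (proj₁ (proj₂ u)) step) (≤Bub⇒ascends steps)

  -- Letters of the same kind are ordered by index, so only mixed pairs need checking.
  shuf-≡ : ∀ {u w : Wrd} → IsShuf u → IsShuf w →
           (∀ {z} → z ∈ u → z ∈ w) → (∀ {z} → z ∈ w → z ∈ u) →
           (∀ {i j} → Before (y j) (x i) u → Before (y j) (x i) w) →
           (∀ {i j} → Before (y j) (x i) w → Before (y j) (x i) u) → u ≡ w
  shuf-≡ {u} {w} su sw u⊆w w⊆u yx⇒ yx⇐ = unique-≡ u w (proj₁ su) (proj₁ sw) u⊆w w⊆u before⇒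
    where
    before⇒ : ∀ {a b} → Before a b u → Before a b w
    before⇒ {x i} {x k} r = before-comparable su sw r (u⊆w (before-∈ˡ r)) (u⊆w (before-∈ʳ r))
                              (comparable-x λ { refl → before-irrefl (proj₁ su) r })
    before⇒ {y j} {y l} r = before-comparable su sw r (u⊆w (before-∈ˡ r)) (u⊆w (before-∈ʳ r))
                              (comparable-y λ { refl → before-irrefl (proj₁ su) r })
    before⇒ {y j} {x i} r = yx⇒ r
    before⇒ {x i} {y j} r with before-total w (u⊆w (before-∈ˡ r)) (u⊆w (before-∈ʳ r)) (λ ())
    ... | inj₁ r' = r'
    ... | inj₂ r' = ⊥-elim (before-asym (proj₁ su) r (yx⇐ r'))

  between-swap : ∀ a i j b {w : Wrd} →
                 IsShuf (a ++ x i ∷ y j ∷ b) → IsShuf (a ++ y j ∷ x i ∷ b) → IsShuf w →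
                 Ascends (a ++ x i ∷ y j ∷ b) w → Ascends w (a ++ y j ∷ x i ∷ b) →
                 w ≡ a ++ x i ∷ y j ∷ b ⊎ w ≡ a ++ y j ∷ x i ∷ b
  between-swap a i j b {w} su sv sw up down =
    by-order (before-total w (u⊆w (∈-insert a)) (u⊆w (∈-insert⁺ a (∈-insert a))) (λ ()))
    where
    u⊆w : ∀ {z} → z ∈ a ++ x i ∷ y j ∷ b → z ∈ w
    u⊆w {x _} p = x-shrink down (∈-swap a p)
    u⊆w {y _} p = y-grow up p
    w⊆u : ∀ {z} → z ∈ w → z ∈ a ++ x i ∷ y j ∷ b
    w⊆u {x _} p = x-shrink up p
    w⊆u {y _} p = ∈-swap a (y-grow down p)
    by-order : Before (x i) (y j) w ⊎ Before (y j) (x i) w →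
               w ≡ a ++ x i ∷ y j ∷ b ⊎ w ≡ a ++ y j ∷ x i ∷ b
    by-order (inj₁ xy) = inj₁ (sym (shuf-≡ su sw u⊆w w⊆u
      (λ r → yx-persist up r (u⊆w (before-∈ʳ r)))
      (λ r → before-swap a (yx-persist down r (∈-swap a (w⊆u (before-∈ʳ r))))
                           λ { (refl , refl) → before-asym (proj₁ sw) xy r })))
    by-order (inj₂ yx) = inj₂ (sym (shuf-≡ sv sw (u⊆w ∘ ∈-swap a) (∈-swap a ∘ w⊆u) yx⇒
      (λ r → yx-persist down r (∈-swap a (w⊆u (before-∈ʳ r))))))
      where
      yx⇒ : ∀ {i' j'} → Before (y j') (x i') (a ++ y j ∷ x i ∷ b) → Before (y j') (x i') w
      yx⇒ {i'} {j'} r with y j' ≟L y j | x i' ≟L x i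
      ... | yes refl | yes refl = yx
      ... | no j'≢j  | _       = yx-persist up (before-swap a r (j'≢j ∘ proj₁)) (u⊆w (∈-swap a (before-∈ʳ r)))
      ... | yes _    | no i'≢i = yx-persist up (before-swap a r (i'≢i ∘ proj₂)) (u⊆w (∈-swap a (before-∈ʳ r)))

  -- The head x_k of b separates x_i from the y's of b, in u as well as (by the invariants) in w.
  deleted-x-before-tail-y : ∀ a i b → HeadNotY b → ∀ {w j} → IsShuf (a ++ x i ∷ b) → IsShuf w →
                            Ascends w (a ++ b) → x i ∈ w → y j ∈ b → ¬ Before (y j) (x i) w
  deleted-x-before-tail-y a i (y _ ∷ b) () _ _ _ _ _
  deleted-x-before-tail-y a i (x k ∷ b) _ {w} {j} su sw down x∈w (there y∈b) yx =
    before-asym (proj₁ sw) (before-trans (proj₁ sw) xi-before-xk xk-before-y) yx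
    where
    uu = proj₁ su
    xk∈w : x k ∈ w
    xk∈w = x-shrink down (∈-insert a)
    xk-before-y : Before (x k) (y j) w
    xk-before-y with before-total w xk∈w (before-∈ˡ yx) (λ ())
    ... | inj₁ r = r
    ... | inj₂ r = ⊥-elim (before-asym uu (before-++ˡ a (before-there (before-here y∈b)))
                                          (before-insert a (yx-persist down r (∈-insert a))))
    xi-before-xk : Before (x i) (x k) w
    xi-before-xk = before-comparable su sw (before-++ˡ a (before-here (here refl))) x∈w xk∈w
                     (comparable-x λ { refl → proj₂ (unique-insert⁻ a uu) (here refl) })

  between-delete : ∀ a i b → HeadNotY b → ∀ {w : Wrd} →
                   IsShuf (a ++ x i ∷ b) → IsShuf (a ++ b) → IsShuf w →
                   Ascends (a ++ x i ∷ b) w → Ascends w (a ++ b) → w ≡ a ++ x i ∷ b ⊎ w ≡ a ++ b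
  between-delete a i b notY {w} su sv sw up down = by-presence (DecMembership._∈?_ _≟L_ (x i) w)
    where
    by-presence : Dec (x i ∈ w) → w ≡ a ++ x i ∷ b ⊎ w ≡ a ++ b
    by-presence (no x∉w) = inj₂ (shuf-≡ sw sv w⊆v v⊆w
      (λ r → yx-persist down r (w⊆v (before-∈ʳ r)))
      (λ r → yx-persist up (before-insert a r) (v⊆w (before-∈ʳ r))))
      where
      w⊆v : ∀ {z} → z ∈ w → z ∈ a ++ b
      w⊆v {x _} p = [ (λ { refl → ⊥-elim (x∉w p) }) , id ]′ (∈-insert⁻ a (x-shrink up p))
      w⊆v {y _} p = y-grow down p
      v⊆w : ∀ {z} → z ∈ a ++ b → z ∈ w
      v⊆w {x _} p = x-shrink down p
      v⊆w {y _} p = y-grow up (∈-insert⁺ a p)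
    by-presence (yes x∈w) = inj₁ (shuf-≡ sw su w⊆u u⊆w yx⇒ (λ r → yx-persist up r (u⊆w (before-∈ʳ r))))
      where
      w⊆u : ∀ {z} → z ∈ w → z ∈ a ++ x i ∷ b
      w⊆u {x _} p = x-shrink up p
      w⊆u {y _} p = ∈-insert⁺ a (y-grow down p)
      u⊆w : ∀ {z} → z ∈ a ++ x i ∷ b → z ∈ w
      u⊆w {x k} p with x k ≟L x i
      ... | yes refl = x∈w
      ... | no xk≢xi = x-shrink down ([ ⊥-elim ∘ xk≢xi , id ]′ (∈-insert⁻ a p))
      u⊆w {y _} p = y-grow up p
      yx⇒ : ∀ {i' j'} → Before (y j') (x i') w → Before (y j') (x i') (a ++ x i ∷ b)
      yx⇒ {i'} r with x i' ≟L x i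
      ... | no xi'≢xi = before-insert a (yx-persist down r
                          ([ ⊥-elim ∘ xi'≢xi , id ]′ (∈-insert⁻ a (w⊆u (before-∈ʳ r)))))
      ... | yes refl with ∈-insert⁻ a (w⊆u (before-∈ˡ r))
      ...   | inj₂ y∈a++b with ∈-++⁻ a y∈a++b
      ...     | inj₁ y∈a = before-inserted a y∈a
      ...     | inj₂ y∈b = ⊥-elim (deleted-x-before-tail-y a i b notY su sw down x∈w y∈b r)

  -- The head y_k of b separates y_j from the x's of b, in v as well as (by the invariants) in w.
  inserted-y-before-tail-x : ∀ a j b → HeadNotX b → ∀ {w i} → IsShuf (a ++ y j ∷ b) → IsShuf w →
                             Ascends (a ++ b) w → Ascends w (a ++ y j ∷ b) → y j ∈ w →
                             Before (y j) (x i) (a ++ y j ∷ b) → Before (y j) (x i) w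
  inserted-y-before-tail-x a j b notX sv sw up down y∈w r with after-inserted a (proj₁ sv) r
  inserted-y-before-tail-x a j (x _ ∷ b) () sv sw up down y∈w r | _
  inserted-y-before-tail-x a j (y k ∷ b) _ {w} {i} sv sw up down y∈w r | there x∈b =
    before-trans (proj₁ sw) yj-before-yk yk-before-x
    where
    uv = proj₁ sv
    yk-before-x : Before (y k) (x i) w
    yk-before-x = yx-persist up (before-++ˡ a (before-here x∈b)) (x-shrink down (before-∈ʳ r))
    yj-before-yk : Before (y j) (y k) w
    yj-before-yk = before-comparable sv sw (before-++ˡ a (before-here (here refl))) y∈w
                     (y-grow up (∈-++⁺ʳ a (here refl)))
                     (comparable-y λ { refl → proj₂ (unique-insert⁻ a uv) (here refl) })

  between-insert : ∀ a j b → HeadNotX b → ∀ {w : Wrd} →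
                   IsShuf (a ++ b) → IsShuf (a ++ y j ∷ b) → IsShuf w →
                   Ascends (a ++ b) w → Ascends w (a ++ y j ∷ b) → w ≡ a ++ b ⊎ w ≡ a ++ y j ∷ b
  between-insert a j b notX {w} su sv sw up down = by-presence (DecMembership._∈?_ _≟L_ (y j) w)
    where
    by-presence : Dec (y j ∈ w) → w ≡ a ++ b ⊎ w ≡ a ++ y j ∷ b
    by-presence (no y∉w) = inj₁ (shuf-≡ sw su w⊆u u⊆w
      (λ r → before-delete a (yx-persist down r (∈-insert⁺ a (w⊆u (before-∈ʳ r))))
                             (λ { refl → y∉w (before-∈ˡ r) }) (λ ()))
      (λ r → yx-persist up r (u⊆w (before-∈ʳ r))))
      where
      w⊆u : ∀ {z} → z ∈ w → z ∈ a ++ b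
      w⊆u {x _} p = x-shrink up p
      w⊆u {y _} p = [ (λ { refl → ⊥-elim (y∉w p) }) , id ]′ (∈-insert⁻ a (y-grow down p))
      u⊆w : ∀ {z} → z ∈ a ++ b → z ∈ w
      u⊆w {x _} p = x-shrink down (∈-insert⁺ a p)
      u⊆w {y _} p = y-grow up p
    by-presence (yes y∈w) = inj₂ (shuf-≡ sw sv w⊆v v⊆w (λ r → yx-persist down r (w⊆v (before-∈ʳ r))) yx⇐)
      where
      w⊆v : ∀ {z} → z ∈ w → z ∈ a ++ y j ∷ b
      w⊆v {x _} p = ∈-insert⁺ a (x-shrink up p)
      w⊆v {y _} p = y-grow down p
      v⊆w : ∀ {z} → z ∈ a ++ y j ∷ b → z ∈ w
      v⊆w {x _} p = x-shrink down p
      v⊆w {y k} p with y k ≟L y j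
      ... | yes refl = y∈w
      ... | no yk≢yj = y-grow up ([ ⊥-elim ∘ yk≢yj , id ]′ (∈-insert⁻ a p))
      yx⇐ : ∀ {i' j'} → Before (y j') (x i') (a ++ y j ∷ b) → Before (y j') (x i') w
      yx⇐ {j' = j'} r with y j' ≟L y j
      ... | yes refl  = inserted-y-before-tail-x a j b notX sv sw up down y∈w r
      ... | no yj'≢yj = yx-persist up (before-delete a r yj'≢yj (λ ())) (v⊆w (before-∈ʳ r))

  coverMove-between : ∀ {u v w : Wrd} → IsShuf u → IsShuf v → IsShuf w → CoverMove u v →
                      Ascends u w → Ascends w v → w ≡ u ⊎ w ≡ v
  coverMove-between su sv sw (cover-delete a i b notY) = between-delete a i b notY su sv sw
  coverMove-between su sv sw (cover-insert a j b notX) = between-insert a j b notX su sv sw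
  coverMove-between su sv sw (cover-swap a i j b)      = between-swap a i j b su sv sw

  coverMove⇒⋖ : ∀ (u v : Shuf m n) → CoverMove (proj₁ u) (proj₁ v) → u ⋖ v
  coverMove⇒⋖ (u , su) (v , sv) c = (coverMove⇒move c ◅ ε , move⇒≢ (coverMove⇒move c)) , nothing-between
    where
    nothing-between : ¬ (Σ (Shuf m n) λ w → ((u , su) <Bub w) × (w <Bub (v , sv)))
    nothing-between ((w , sw) , (u≤w , u≢w) , (w≤v , w≢v)) =
      [ u≢w ∘ sym , w≢v ]′ (coverMove-between su sv sw c (≤Bub⇒ascends u≤w) (≤Bub⇒ascends w≤v))

  coverMove⇒adjacent : ∀ {u v} → Unique u → Unique v → CoverMove u v → Adjacent u v
  coverMove⇒adjacent uu _  (cover-delete a i b notY) = delete-adjacent a i b notY uu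
  coverMove⇒adjacent _  uv (cover-insert a j b notX) = insert-adjacent a j b notX uv
  coverMove⇒adjacent uu _  (cover-swap a i j b)      = swap-adjacent a i j b uu

-- Adjacent facets come from cover moves

  adjacent-sym : ∀ {u v} → IsShuf u → IsShuf v → Adjacent u v → Adjacent v u
  adjacent-sym {u} {v} su sv adj =
    trans (cong suc (shared-comm (F v) (F u) (F-unique v (proj₁ sv)) (F-unique u (proj₁ su)))) adj

  lone-difference : ∀ {u v} → IsShuf u → Adjacent u v → ∀ {e₁ e₂} → e₁ ∈ F u → e₁ ∉ F v →
                    e₂ ∈ F u → e₂ ∉ F v → e₁ ≡ e₂
  lone-difference {u} {v} su adj {e₁} {e₂} e₁∈ e₁∉ e₂∈ e₂∉ with e₁ ≟E e₂
  ... | yes e₁≡e₂ = e₁≡e₂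
  ... | no e₁≢e₂  = ⊥-elim (ℕ.<-irrefl refl (ℕ.≤-trans
        (shared-two-missing (F u) (F v) e₁∈ e₂∈ e₁≢e₂ e₁∉ e₂∉)
        (ℕ.≤-reflexive (trans (length-F u (proj₁ su)) (sym adj)))))

  data FirstDifference : Wrd → Wrd → Set where
    both-end     : FirstDifference [] []
    left-end     : ∀ d V → FirstDifference [] (d ∷ V)
    right-end    : ∀ c U → FirstDifference (c ∷ U) []
    heads-differ : ∀ c U d V → c ≢ d → FirstDifference (c ∷ U) (d ∷ V)

  split-common-prefix : ∀ (U V : Wrd) →
    ∃ λ p → ∃ λ U' → ∃ λ V' → U ≡ p ++ U' × V ≡ p ++ V' × FirstDifference U' V'
  split-common-prefix []      []      = [] , [] , [] , refl , refl , both-end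
  split-common-prefix []      (d ∷ V) = [] , [] , d ∷ V , refl , refl , left-end d V
  split-common-prefix (c ∷ U) []      = [] , c ∷ U , [] , refl , refl , right-end c U
  split-common-prefix (c ∷ U) (d ∷ V) with c ≟L d
  ... | no c≢d = [] , c ∷ U , d ∷ V , refl , refl , heads-differ c U d V c≢d
  ... | yes refl with split-common-prefix U V
  ...   | p , U' , V' , U≡ , V≡ , fd = c ∷ p , U' , V' , cong (c ∷_) U≡ , cong (c ∷_) V≡ , fd

  FromTail : Fin (suc m) → Fin (suc n) → Wrd → Wrd → Elt → Set
  FromTail lx ly U V e = (∃ λ z → e ≡ loop z × (z ∈ U ⊎ z ∈ V)) ⊎ e ∈ edgesFrom lx ly U

  -- Knowing that a difference comes from the tails is what tells it apart from the differences
  -- created at the first differing letters.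
  TailDifference : Wrd → Wrd → Wrd → Wrd → Wrd → Wrd → Set
  TailDifference u v P Q U V =
      (∃ λ e → e ∈ F u × e ∉ F v × FromTail (lastX₀ P) (lastY₀ P) U V e)
    ⊎ (∃ λ e → e ∈ F v × e ∉ F u × FromTail (lastX₀ Q) (lastY₀ Q) V U e)

  fromTail-++ : ∀ (P p : Wrd) {U V e} → FromTail (lastX₀ (P ++ p)) (lastY₀ (P ++ p)) U V e →
                FromTail (lastX₀ P) (lastY₀ P) (p ++ U) (p ++ V) e
  fromTail-++ P p (inj₁ (z , e≡ , inj₁ z∈U)) = inj₁ (z , e≡ , inj₁ (∈-++⁺ʳ p z∈U))
  fromTail-++ P p (inj₁ (z , e≡ , inj₂ z∈V)) = inj₁ (z , e≡ , inj₂ (∈-++⁺ʳ p z∈V))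
  fromTail-++ P p {U} {e = e} (inj₂ r) = inj₂ (subst (e ∈_) (sym (edgesFrom-++ (lastX₀ P) (lastY₀ P) p U))
    (∈-++⁺ʳ _ (subst₂ (λ a b → e ∈ edgesFrom a b U) (lastX-++ fzero P p) (lastY-++ fzero P p) r)))

  fromTail≢edge-x : ∀ {lx ly U V e a b} → FromTail lx ly U V e → a ≢ lx →
                    (∀ {k} → a ≡ fsuc k → x k ∉ U) → e ≢ edge a b
  fromTail≢edge-x (inj₁ (z , refl , _)) _    _   = loop≢edge z
  fromTail≢edge-x (inj₂ r)              a≢lx x∉U refl = edge∉edgesFrom-x (¬xSeen a≢lx x∉U) r

  fromTail≢edge-y : ∀ {lx ly U V e a b} → FromTail lx ly U V e → b ≢ ly →
                    (∀ {k} → b ≡ fsuc k → y k ∉ U) → e ≢ edge a b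
  fromTail≢edge-y (inj₁ (z , refl , _)) _    _   = loop≢edge z
  fromTail≢edge-y (inj₂ r)              b≢ly y∉U refl = edge∉edgesFrom-y (¬ySeen b≢ly y∉U) r

  fromTail≢loop : ∀ {lx ly U V e} z → FromTail lx ly U V e → z ∉ U → z ∉ V → e ≢ loop z
  fromTail≢loop z (inj₁ (z' , refl , z'∈)) z∉U z∉V e≡ with loop-injective e≡
  ... | refl = [ z∉U , z∉V ]′ z'∈
  fromTail≢loop z (inj₂ r) _ _ refl = loop∉edgesFrom z r

  PrefixConsistent : Wrd → Wrd → Wrd → Set
  PrefixConsistent P Q v = ∀ {z} → z ∈ P → z ∈ Q ⊎ z ∉ v

  head∉prefix : ∀ (P U Q : Wrd) {c} → Unique (P ++ c ∷ U) → PrefixConsistent Q P (P ++ c ∷ U) → c ∉ Q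
  head∉prefix P U Q u rec c∈Q = [ proj₁ (unique-insert⁻ P u) , (λ c∉ → c∉ (∈-insert P)) ]′ (rec c∈Q)

  smaller-head-absent : ∀ P U Q V {c d} → IsShuf (P ++ c ∷ U) → IsShuf (Q ++ d ∷ V) →
                        PrefixConsistent Q P (P ++ c ∷ U) → c ≢ d → MustPrecede c d → c ∉ Q ++ d ∷ V
  smaller-head-absent P U Q V su sv recQ c≢d c≺d =
    ∉-insert Q (head∉prefix P U Q (proj₁ su) recQ) c≢d (λ p → ordered-after Q sv p c≺d)

  -- At the first difference of the tails the scans of u and v read different letters after the same
  -- last x and last y, so some element of one facet is missing from the other.
  tail-difference-at : ∀ {u v} P U Q V → u ≡ P ++ U → v ≡ Q ++ V → IsShuf u → IsShuf v →
                       lastX₀ P ≡ lastX₀ Q → lastY₀ P ≡ lastY₀ Q → PrefixConsistent P Q v → PrefixConsistent Q P u →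
                       U ≢ V → FirstDifference U V → TailDifference u v P Q U V
  tail-difference-at P U Q V _ _ _ _ _ _ _ _ U≢V both-end = ⊥-elim (U≢V refl)
  tail-difference-at P _ Q _ refl refl su sv _ _ recP _ _ (left-end d V) =
    inj₁ (loop d , loop∈F d d∉u , loop∉F (∈-insert Q) , inj₁ (d , refl , inj₂ (here refl)))
    where
    d∉u : d ∉ P ++ []
    d∉u p = [ (λ d∈P → head∉prefix Q V P (proj₁ sv) recP d∈P) , (λ ()) ]′ (∈-++⁻ P p)
  tail-difference-at P _ Q _ refl refl su sv _ _ _ recQ _ (right-end c U) =
    inj₂ (loop c , loop∈F c c∉v , loop∉F (∈-insert P) , inj₁ (c , refl , inj₂ (here refl)))
    where
    c∉v : c ∉ Q ++ []
    c∉v p = [ (λ c∈Q → head∉prefix P U Q (proj₁ su) recQ c∈Q) , (λ ()) ]′ (∈-++⁻ Q p)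
  tail-difference-at P _ Q _ refl refl su sv _ _ recP recQ _ (heads-differ (x i) U (x k) V xi≢xk)
    with Fin.<-cmp i k
  ... | tri≈ _ refl _ = ⊥-elim (xi≢xk refl)
  ... | tri< i<k _ _ = inj₁ (_ , ∈-F-++ʳ P (x i ∷ U) (here refl) ,
          edge∉F-absentX _ (smaller-head-absent P U Q V su sv recQ xi≢xk i<k) ,
          inj₂ (here refl))
  ... | tri> _ _ k<i = inj₂ (_ , ∈-F-++ʳ Q (x k ∷ V) (here refl) ,
          edge∉F-absentX _ (smaller-head-absent Q V P U sv su recP (xi≢xk ∘ sym) k<i) ,
          inj₂ (here refl))
  tail-difference-at P _ Q _ refl refl su sv _ _ recP recQ _ (heads-differ (y j) U (y l) V yj≢yl)
    with Fin.<-cmp j l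
  ... | tri≈ _ refl _ = ⊥-elim (yj≢yl refl)
  ... | tri< j<l _ _ = inj₁ (_ , ∈-F-++ʳ P (y j ∷ U) (here refl) ,
          edge∉F-absentY _ (smaller-head-absent P U Q V su sv recQ yj≢yl j<l) ,
          inj₂ (here refl))
  ... | tri> _ _ l<j = inj₂ (_ , ∈-F-++ʳ Q (y l ∷ V) (here refl) ,
          edge∉F-absentY _ (smaller-head-absent Q V P U sv su recP (yj≢yl ∘ sym) l<j) ,
          inj₂ (here refl))
  tail-difference-at P _ Q _ refl refl su sv _ sameY _ recQ _ (heads-differ (x i) U (y j) V _) =
    inj₁ (_ , ∈-F-++ʳ P (x i ∷ U) (here refl) ,
          subst (λ b → edge (fsuc i) b ∉ F (Q ++ y j ∷ V)) (sym sameY)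
                (edge∉F-x-after-y Q j V (proj₁ sv) (head∉prefix P U Q (proj₁ su) recQ)) ,
          inj₂ (here refl))
  tail-difference-at P _ Q _ refl refl su sv _ sameY recP _ _ (heads-differ (y j) U (x i) V _) =
    inj₂ (_ , ∈-F-++ʳ Q (x i ∷ V) (here refl) ,
          subst (λ b → edge (fsuc i) b ∉ F (P ++ y j ∷ U)) sameY
                (edge∉F-x-after-y P j U (proj₁ su) (head∉prefix Q V P (proj₁ sv) recP)) ,
          inj₂ (here refl))

  tail-difference : ∀ {u v} P U Q V → u ≡ P ++ U → v ≡ Q ++ V → IsShuf u → IsShuf v →
                    lastX₀ P ≡ lastX₀ Q → lastY₀ P ≡ lastY₀ Q → PrefixConsistent P Q v → PrefixConsistent Q P u →
                    U ≢ V → TailDifference u v P Q U V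
  tail-difference {u} {v} P U Q V u≡ v≡ su sv sameX sameY recP recQ U≢V with split-common-prefix U V
  ... | p , U' , V' , refl , refl , fd =
    Sum.map (λ (e , e∈ , e∉ , t) → e , e∈ , e∉ , fromTail-++ P p t)
                 (λ (e , e∈ , e∉ , t) → e , e∈ , e∉ , fromTail-++ Q p t)
      (tail-difference-at (P ++ p) U' (Q ++ p) V'
        (trans u≡ (sym (List.++-assoc P p U'))) (trans v≡ (sym (List.++-assoc Q p V'))) su sv
        (trans (lastX-++ fzero P p) (trans (cong (λ l → lastX l p) sameX) (sym (lastX-++ fzero Q p))))
        (trans (lastY-++ fzero P p) (trans (cong (λ l → lastY l p) sameY) (sym (lastY-++ fzero Q p))))
        (extend recP) (extend recQ) (U≢V ∘ cong (p ++_)) fd)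
    where
    extend : ∀ {P Q w} → PrefixConsistent P Q w → PrefixConsistent (P ++ p) (Q ++ p) w
    extend {P} {Q} rec q with ∈-++⁻ P q
    ... | inj₁ r = Sum.map₁ ∈-++⁺ˡ (rec r)
    ... | inj₂ r = inj₁ (∈-++⁺ʳ Q r)

  tail-difference-after : ∀ p s t U V → IsShuf (p ++ s ++ U) → IsShuf (p ++ t ++ V) →
    lastX (lastX₀ p) s ≡ lastX (lastX₀ p) t → lastY (lastY₀ p) s ≡ lastY (lastY₀ p) t →
    PrefixConsistent s t (p ++ t ++ V) → PrefixConsistent t s (p ++ s ++ U) → U ≢ V →
    TailDifference (p ++ s ++ U) (p ++ t ++ V) (p ++ s) (p ++ t) U V
  tail-difference-after p s t U V su sv sameX sameY recs rect U≢V =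
    tail-difference (p ++ s) U (p ++ t) V (sym (List.++-assoc p s U)) (sym (List.++-assoc p t V)) su sv
      (trans (lastX-++ fzero p s) (trans sameX (sym (lastX-++ fzero p t))))
      (trans (lastY-++ fzero p s) (trans sameY (sym (lastY-++ fzero p t))))
      (after-common-prefix recs) (after-common-prefix rect) U≢V
    where
    after-common-prefix : ∀ {s t w} → PrefixConsistent s t w → PrefixConsistent (p ++ s) (p ++ t) w
    after-common-prefix rec q with ∈-++⁻ p q
    ... | inj₁ r = inj₁ (∈-++⁺ˡ r)
    ... | inj₂ r = Sum.map₁ (∈-++⁺ʳ p) (rec r)

  -- u = p x_i U and v = p x_k V with i < k. The differences are e₁ = {x_i, last y of p} in F u and the
  -- loop of x_i in F v; any U other than x_k V yields a third one.
  module AdjacentXX {p i U k V} (i<k : i <ᶠ k) (su : IsShuf (p ++ x i ∷ U)) (sv : IsShuf (p ++ x k ∷ V))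
                    (adj : Adjacent (p ++ x i ∷ U) (p ++ x k ∷ V)) where
    private
      uu = proj₁ su
      uv = proj₁ sv

    xi∉v : x i ∉ p ++ x k ∷ V
    xi∉v = smaller-head-absent p U p V su sv inj₁ (Fin.<⇒≢ i<k ∘ x-inj) i<k

    only-e₁ : ∀ {e} → e ∈ F (p ++ x i ∷ U) → e ∉ F (p ++ x k ∷ V) →
              e ≢ edge (fsuc i) (lastY₀ p) → ⊥
    only-e₁ e∈ e∉ e≢ = e≢ (lone-difference su adj e∈ e∉
                               (∈-F-++ʳ p (x i ∷ U) (here refl)) (edge∉F-absentX _ xi∉v))

    only-loop : ∀ {e} → e ∈ F (p ++ x k ∷ V) → e ∉ F (p ++ x i ∷ U) → e ≢ loopX i → ⊥
    only-loop e∈ e∉ e≢ = e≢ (lone-difference sv (adjacent-sym su sv adj) e∈ e∉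
                                 (loop∈F (x i) xi∉v) (loop∉F (∈-insert p)))

    loopXk-difference : x k ∉ U → ⊥
    loopXk-difference xk∉U = only-e₁ (loop∈F (x k) xk∉u) (loop∉F (∈-insert p)) (λ ())
      where
      xk∉u : x k ∉ p ++ x i ∷ U
      xk∉u = ∉-insert p (proj₁ (unique-insert⁻ p uv)) (Fin.<⇒≢ i<k ∘ sym ∘ x-inj) xk∉U

    after-xk : ∀ U' → U ≡ x k ∷ U' → CoverMove (p ++ x i ∷ U) (p ++ x k ∷ V)
    after-xk U' refl with List.≡-dec _≟L_ U' V
    ... | yes refl = cover-delete p i (x k ∷ V) tt
    ... | no U'≢V with tail-difference-after p (x i ∷ x k ∷ []) (x k ∷ []) U' V su sv refl refl
                         (λ { (here refl) → inj₂ xi∉v ; (there (here refl)) → inj₁ (here refl) })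
                         (λ { (here refl) → inj₁ (there (here refl)) }) U'≢V
    ...   | inj₁ (e , e∈ , e∉ , t) = ⊥-elim (only-e₁ e∈ e∉ λ e≡ → fromTail≢edge-x t
            (λ last≡ → Fin.<⇒≢ i<k (Fin.suc-injective (trans last≡ (lastX-++ fzero p (x i ∷ x k ∷ [])))))
            (λ { refl q → proj₂ (unique-insert⁻ p uu) (there q) }) e≡)
    ...   | inj₂ (e , e∈ , e∉ , t) = ⊥-elim (only-loop e∈ e∉ λ e≡ → fromTail≢loop (x i) t
            (λ q → xi∉v (∈-++⁺ʳ p (there q))) (λ q → proj₂ (unique-insert⁻ p uu) (there q)) e≡)

    by-next-letter : ∀ U' → U' ≡ U → CoverMove (p ++ x i ∷ U) (p ++ x k ∷ V)
    by-next-letter [] refl = ⊥-elim (loopXk-difference λ ())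
    by-next-letter (y j ∷ U') refl = ⊥-elim (only-e₁
      (∈-F-++ʳ p (x i ∷ y j ∷ U') (there (here refl))) (edge∉F-absentX _ xi∉v)
      (λ e≡ → lastY₀-fresh p uu (sym (edge-injectiveʳ e≡)) (there (here refl))))
    by-next-letter (x l ∷ U') refl with Fin.<-cmp l k
    ... | tri≈ _ refl _ = after-xk U' refl
    ... | tri< l<k _ _ = ⊥-elim (only-e₁
      (∈-F-++ʳ p (x i ∷ x l ∷ U') (there (here refl)))
      (edge∉F-absentX _ (∉-insert p (λ q → unique-++-disjoint p uu q (there (here refl))) (Fin.<⇒≢ l<k ∘ x-inj)
                                    (λ q → ordered-after p sv q l<k)))
      (λ e≡ → proj₂ (unique-insert⁻ p uu) (here (cong x (Fin.suc-injective (sym (edge-injectiveˡ e≡)))))))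
    ... | tri> _ _ k<l = ⊥-elim (loopXk-difference λ
      { (here e)  → Fin.<⇒≢ k<l (x-inj e)
      ; (there q) → ordered-before (isShuf⇒ordered su) (before-++ˡ p (before-there (before-here q))) k<l })

    coverMove : CoverMove (p ++ x i ∷ U) (p ++ x k ∷ V)
    coverMove = by-next-letter U refl

  module AdjacentYY {p j U l V} (j<l : j <ᶠ l) (su : IsShuf (p ++ y j ∷ U)) (sv : IsShuf (p ++ y l ∷ V))
                    (adj : Adjacent (p ++ y j ∷ U) (p ++ y l ∷ V)) where
    private
      uu = proj₁ su
      uv = proj₁ sv

    yj∉v : y j ∉ p ++ y l ∷ V
    yj∉v = smaller-head-absent p U p V su sv inj₁ (Fin.<⇒≢ j<l ∘ y-inj) j<l

    only-e₁ : ∀ {e} → e ∈ F (p ++ y j ∷ U) → e ∉ F (p ++ y l ∷ V) →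
              e ≢ edge (lastX₀ p) (fsuc j) → ⊥
    only-e₁ e∈ e∉ e≢ = e≢ (lone-difference su adj e∈ e∉
                               (∈-F-++ʳ p (y j ∷ U) (here refl)) (edge∉F-absentY _ yj∉v))

    only-loop : ∀ {e} → e ∈ F (p ++ y l ∷ V) → e ∉ F (p ++ y j ∷ U) → e ≢ loopY j → ⊥
    only-loop e∈ e∉ e≢ = e≢ (lone-difference sv (adjacent-sym su sv adj) e∈ e∉
                                 (loop∈F (y j) yj∉v) (loop∉F (∈-insert p)))

    loopYl-difference : y l ∉ U → ⊥
    loopYl-difference yl∉U = only-e₁ (loop∈F (y l) yl∉u) (loop∉F (∈-insert p)) (λ ())
      where
      yl∉u : y l ∉ p ++ y j ∷ U
      yl∉u = ∉-insert p (proj₁ (unique-insert⁻ p uv)) (Fin.<⇒≢ j<l ∘ sym ∘ y-inj) yl∉U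

    after-yl : ∀ U' → U ≡ y l ∷ U' → CoverMove (p ++ y l ∷ V) (p ++ y j ∷ U)
    after-yl U' refl with List.≡-dec _≟L_ U' V
    ... | yes refl = cover-insert p j (y l ∷ V) tt
    ... | no U'≢V with tail-difference-after p (y j ∷ y l ∷ []) (y l ∷ []) U' V su sv refl refl
                         (λ { (here refl) → inj₂ yj∉v ; (there (here refl)) → inj₁ (here refl) })
                         (λ { (here refl) → inj₁ (there (here refl)) }) U'≢V
    ...   | inj₁ (e , e∈ , e∉ , t) = ⊥-elim (only-e₁ e∈ e∉ λ e≡ → fromTail≢edge-y t
            (λ last≡ → Fin.<⇒≢ j<l (Fin.suc-injective (trans last≡ (lastY-++ fzero p (y j ∷ y l ∷ [])))))
            (λ { refl q → proj₂ (unique-insert⁻ p uu) (there q) }) e≡)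
    ...   | inj₂ (e , e∈ , e∉ , t) = ⊥-elim (only-loop e∈ e∉ λ e≡ → fromTail≢loop (y j) t
            (λ q → yj∉v (∈-++⁺ʳ p (there q))) (λ q → proj₂ (unique-insert⁻ p uu) (there q)) e≡)

    by-next-letter : ∀ U' → U' ≡ U → CoverMove (p ++ y l ∷ V) (p ++ y j ∷ U)
    by-next-letter [] refl = ⊥-elim (loopYl-difference λ ())
    by-next-letter (x i ∷ U') refl = ⊥-elim (only-e₁
      (∈-F-++ʳ p (y j ∷ x i ∷ U') (there (here refl))) (edge∉F-absentY _ yj∉v)
      (λ e≡ → lastX₀-fresh p uu (sym (edge-injectiveˡ e≡)) (there (here refl))))
    by-next-letter (y l' ∷ U') refl with Fin.<-cmp l' l
    ... | tri≈ _ refl _ = after-yl U' refl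
    ... | tri< l'<l _ _ = ⊥-elim (only-e₁
      (∈-F-++ʳ p (y j ∷ y l' ∷ U') (there (here refl)))
      (edge∉F-absentY _ (∉-insert p (λ q → unique-++-disjoint p uu q (there (here refl))) (Fin.<⇒≢ l'<l ∘ y-inj)
                                    (λ q → ordered-after p sv q l'<l)))
      (λ e≡ → proj₂ (unique-insert⁻ p uu) (here (cong y (Fin.suc-injective (sym (edge-injectiveʳ e≡)))))))
    ... | tri> _ _ l<l' = ⊥-elim (loopYl-difference λ
      { (here e)  → Fin.<⇒≢ l<l' (y-inj e)
      ; (there q) → ordered-before (isShuf⇒ordered su) (before-++ˡ p (before-there (before-here q))) l<l' })

    coverMove : CoverMove (p ++ y l ∷ V) (p ++ y j ∷ U)
    coverMove = by-next-letter U refl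

  -- u = p x_i U and v = p y_j V. The differences are e₁ = {x_i, last y of p} in F u and
  -- e₂ = {last x of p, y_j} in F v, which forces u = p x_i y_j U' and v = p y_j x_i U'.
  module AdjacentXY {p i U j V} (su : IsShuf (p ++ x i ∷ U)) (sv : IsShuf (p ++ y j ∷ V))
                    (adj : Adjacent (p ++ x i ∷ U) (p ++ y j ∷ V)) where
    private
      uu = proj₁ su
      uv = proj₁ sv

    only-e₁ : ∀ {e} → e ∈ F (p ++ x i ∷ U) → e ∉ F (p ++ y j ∷ V) →
              e ≢ edge (fsuc i) (lastY₀ p) → ⊥
    only-e₁ e∈ e∉ e≢ = e≢ (lone-difference su adj e∈ e∉ (∈-F-++ʳ p (x i ∷ U) (here refl))
                               (edge∉F-x-after-y p j V uv (proj₁ (unique-insert⁻ p uu))))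

    only-e₂ : ∀ {e} → e ∈ F (p ++ y j ∷ V) → e ∉ F (p ++ x i ∷ U) →
              e ≢ edge (lastX₀ p) (fsuc j) → ⊥
    only-e₂ e∈ e∉ e≢ = e≢ (lone-difference sv (adjacent-sym su sv adj) e∈ e∉
                               (∈-F-++ʳ p (y j ∷ V) (here refl))
                               (edge∉F-y-after-x p i U uu (proj₁ (unique-insert⁻ p uv))))

    yj∈U : y j ∈ U
    yj∈U with DecMembership._∈?_ _≟L_ (y j) (p ++ x i ∷ U)
    ... | no yj∉u  = ⊥-elim (only-e₁ (loop∈F (y j) yj∉u) (loop∉F (∈-insert p)) (λ ()))
    ... | yes yj∈u with ∈-insert⁻ p yj∈u
    ...   | inj₂ q = [ ⊥-elim ∘ proj₁ (unique-insert⁻ p uv) , id ]′ (∈-++⁻ p q)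

    xi∈V : x i ∈ V
    xi∈V with DecMembership._∈?_ _≟L_ (x i) (p ++ y j ∷ V)
    ... | no xi∉v  = ⊥-elim (only-e₂ (loop∈F (x i) xi∉v) (loop∉F (∈-insert p)) (λ ()))
    ... | yes xi∈v with ∈-insert⁻ p xi∈v
    ...   | inj₂ q = [ ⊥-elim ∘ proj₁ (unique-insert⁻ p uu) , id ]′ (∈-++⁻ p q)

    after-swap : ∀ U' V' → U ≡ y j ∷ U' → V ≡ x i ∷ V' → CoverMove (p ++ x i ∷ U) (p ++ y j ∷ V)
    after-swap U' V' refl refl with List.≡-dec _≟L_ U' V'
    ... | yes refl = cover-swap p i j U'
    ... | no U'≢V' with tail-difference-after p (x i ∷ y j ∷ []) (y j ∷ x i ∷ []) U' V' su sv refl refl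
                          (inj₁ ∘ ∈-swap []) (inj₁ ∘ ∈-swap []) U'≢V'
    ...   | inj₁ (e , e∈ , e∉ , t) = ⊥-elim (only-e₁ e∈ e∉ λ e≡ → fromTail≢edge-y t
            (λ last≡ → lastY₀-fresh p uu (trans last≡ (lastY-++ fzero p (x i ∷ y j ∷ []))) (there (here refl)))
            (λ last≡ q → lastY₀-fresh p uu last≡ (there (there q))) e≡)
    ...   | inj₂ (e , e∈ , e∉ , t) = ⊥-elim (only-e₂ e∈ e∉ λ e≡ → fromTail≢edge-x t
            (λ last≡ → lastX₀-fresh p uv (trans last≡ (lastX-++ fzero p (y j ∷ x i ∷ []))) (there (here refl)))
            (λ last≡ q → lastX₀-fresh p uv last≡ (there (there q))) e≡)

    v-next-letter : ∀ U' V' → U ≡ y j ∷ U' → V' ≡ V → CoverMove (p ++ x i ∷ U) (p ++ y j ∷ V)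
    v-next-letter U' [] refl refl with xi∈V
    ... | ()
    v-next-letter U' (y l ∷ V') refl refl = ⊥-elim (only-e₂
      (∈-F-++ʳ p (y j ∷ y l ∷ V') (there (here refl)))
      (edge∉F-y-after-x p i U uu (λ q → unique-++-disjoint p uv q (there (here refl))))
      (λ e≡ → proj₂ (unique-insert⁻ p uv) (here (cong y (Fin.suc-injective (sym (edge-injectiveʳ e≡)))))))
    v-next-letter U' (x l ∷ V') refl refl with x l ≟L x i
    ... | yes refl  = after-swap U' V' refl refl
    ... | no xl≢xi = ⊥-elim (only-e₁ (loop∈F (x l) xl∉u) (loop∉F (∈-insert⁺ p (∈-insert p))) (λ ()))
      where
      l<i : l <ᶠ i
      l<i = before⇒mustPrecede sv (before-++ˡ p (before-there (before-here (∈-∷-≢ xi∈V (xl≢xi ∘ sym)))))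
                                  (comparable-x (xl≢xi ∘ cong x))
      xl∉u : x l ∉ p ++ x i ∷ U
      xl∉u = ∉-insert p (λ q → unique-++-disjoint p uv q (there (here refl))) xl≢xi
                        (λ q → ordered-after p su q l<i)

    u-next-letter : ∀ U' → U' ≡ U → CoverMove (p ++ x i ∷ U) (p ++ y j ∷ V)
    u-next-letter [] refl with yj∈U
    ... | ()
    u-next-letter (x l ∷ U') refl = ⊥-elim (only-e₁
      (∈-F-++ʳ p (x i ∷ x l ∷ U') (there (here refl)))
      (edge∉F-x-after-y p j V uv (λ q → unique-++-disjoint p uu q (there (here refl))))
      (λ e≡ → proj₂ (unique-insert⁻ p uu) (here (cong x (Fin.suc-injective (sym (edge-injectiveˡ e≡)))))))
    u-next-letter (y l ∷ U') refl with y l ≟L y j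
    ... | yes refl  = v-next-letter U' V refl refl
    ... | no yl≢yj = ⊥-elim (only-e₂ (loop∈F (y l) yl∉v) (loop∉F (∈-insert⁺ p (∈-insert p))) (λ ()))
      where
      l<j : l <ᶠ j
      l<j = before⇒mustPrecede su (before-++ˡ p (before-there (before-here (∈-∷-≢ yj∈U (yl≢yj ∘ sym)))))
                                  (comparable-y (yl≢yj ∘ cong y))
      yl∉v : y l ∉ p ++ y j ∷ V
      yl∉v = ∉-insert p (λ q → unique-++-disjoint p uu q (there (here refl))) yl≢yj
                        (λ q → ordered-after p sv q l<j)

    coverMove : CoverMove (p ++ x i ∷ U) (p ++ y j ∷ V)
    coverMove = u-next-letter U refl

  CoverMoveEitherWay : Wrd → Wrd → Set
  CoverMoveEitherWay u v = CoverMove u v ⊎ CoverMove v u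

  adjacent-end : ∀ p d V → IsShuf (p ++ []) → IsShuf (p ++ d ∷ V) →
                 Adjacent (p ++ []) (p ++ d ∷ V) → CoverMoveEitherWay (p ++ []) (p ++ d ∷ V)
  adjacent-end p (x i) []       _  _  _   = inj₂ (cover-delete p i [] tt)
  adjacent-end p (y j) []       _  _  _   = inj₁ (cover-insert p j [] tt)
  adjacent-end p d     (d' ∷ V) su sv adj = ⊥-elim (loop≢ (loop-injective (lone-difference su adj
      (loop∈F d (∉-++ p (proj₁ (unique-insert⁻ p uv)) λ ())) (loop∉F (∈-insert p))
      (loop∈F d' (∉-++ p (λ q → unique-++-disjoint p uv q (there (here refl))) λ ()))
      (loop∉F (∈-insert⁺ p (∈-insert p))))))
    where
    uv = proj₁ sv
    loop≢ : d ≢ d'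
    loop≢ refl = proj₂ (unique-insert⁻ p uv) (here refl)

  adjacent⇒coverMove : ∀ (u v : Wrd) → IsShuf u → IsShuf v → Adjacent u v → CoverMoveEitherWay u v
  adjacent⇒coverMove u v su sv adj with split-common-prefix u v
  ... | p , U , V , refl , refl , fd = at fd su sv adj
    where
    flip : ∀ {u v} → IsShuf u → IsShuf v → Adjacent u v →
           (IsShuf v → IsShuf u → Adjacent v u → CoverMoveEitherWay v u) → CoverMoveEitherWay u v
    flip su sv adj k = Sum.swap (k sv su (adjacent-sym su sv adj))
    at : ∀ {U V} → FirstDifference U V → IsShuf (p ++ U) → IsShuf (p ++ V) → Adjacent (p ++ U) (p ++ V) →
         CoverMoveEitherWay (p ++ U) (p ++ V)
    at both-end su _ adj = ⊥-elim (ℕ.1+n≢n (begin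
      suc (length (F (p ++ [])))                 ≡⟨ cong suc (shared-⊆ (F (p ++ [])) (F (p ++ [])) id) ⟨
      suc (shared (F (p ++ [])) (F (p ++ [])))   ≡⟨ adj ⟩
      m + n                                      ≡⟨ length-F (p ++ []) (proj₁ su) ⟨
      length (F (p ++ []))                       ∎))
      where open ≡-Reasoning
    at (left-end d V)  su sv adj = adjacent-end p d V su sv adj
    at (right-end c U) su sv adj = flip su sv adj (adjacent-end p c U)
    at (heads-differ (x i) U (x k) V xi≢xk) su sv adj with Fin.<-cmp i k
    ... | tri< i<k _ _ = inj₁ (AdjacentXX.coverMove i<k su sv adj)
    ... | tri≈ _ refl _ = ⊥-elim (xi≢xk refl)
    ... | tri> _ _ k<i = inj₂ (AdjacentXX.coverMove k<i sv su (adjacent-sym su sv adj))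
    at (heads-differ (y j) U (y l) V yj≢yl) su sv adj with Fin.<-cmp j l
    ... | tri< j<l _ _ = inj₂ (AdjacentYY.coverMove j<l su sv adj)
    ... | tri≈ _ refl _ = ⊥-elim (yj≢yl refl)
    ... | tri> _ _ l<j = inj₁ (AdjacentYY.coverMove l<j sv su (adjacent-sym su sv adj))
    at (heads-differ (x i) U (y j) V _) su sv adj = inj₁ (AdjacentXY.coverMove su sv adj)
    at (heads-differ (y j) U (x i) V _) su sv adj = inj₂ (AdjacentXY.coverMove sv su (adjacent-sym su sv adj))

n-1≡r-2⇔1+n≡r : ∀ (k r : ℕ) → (+ k - + 1 ≡ + r - + 2) ⇔ (suc k ≡ r)
n-1≡r-2⇔1+n≡r k r = mk⇔
  (λ eq → ℤ.+-injective (∙-cancelʳ (- + 2) (+ suc k) (+ r) (trans (ℤ.[1+m]⊖[1+n]≡m⊖n k 1) eq)))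
  (λ { refl → sym (ℤ.[1+m]⊖[1+n]≡m⊖n k 1) })

lemma4p9 : ∀ (m n : ℕ) (u v : Shuf m n) →
    (dim (F (proj₁ u) ∩ F (proj₁ v)) ≡ + (m + n) - + 2) ⇔ ((u ⋖ v) ⊎ (v ⋖ u))
lemma4p9 m n (u , su) (v , sv) = mk⇔
  (λ dim≡ → Sum.map (coverMove⇒⋖ (u , su) (v , sv)) (coverMove⇒⋖ (v , sv) (u , su))
              (adjacent⇒coverMove u v su sv (to dim≡)))
  λ { (inj₁ u⋖v) → from (coverMove⇒adjacent (proj₁ su) (proj₁ sv) (⋖⇒coverMove u⋖v))
    ; (inj₂ v⋖u) → from (adjacent-sym sv su (coverMove⇒adjacent (proj₁ sv) (proj₁ su) (⋖⇒coverMove v⋖u))) }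
  where open Equivalence (n-1≡r-2⇔1+n≡r (shared (F u) (F v)) (m + n))
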